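{- Let $A$ be the vertex–arc incidence matrix of $G_d$ and let $\succ$ be the pure lexicographic order induced by the variable ordering $x_{i,j}\succ x_{k,l}$ iff $j-i<l-k$, or $j-i=l-k$ and $i<k$. Then the reduced Gröbner basis of $I_A$ with respect to $\succ$ is $\{x_{i,j}x_{j,k}-x_{i,k}: i<j<k\}\cup\{x_{i,l}x_{j,k}-x_{i,k}x_{j,l}: i<j<k<l\}$. In particular it has $\binom d3+\binom d4$ elements.
   Context: $G_d$ has vertices $1,\dots,d$ and arcs $(i,j)$, $1\le i<j\le d$, directed from $i$ to $j$; $n=\binom d2$. Its vertex–arc incidence matrix $A$ has in the column of arc $(i,j)$ entry $1$ in row $i$, $-1$ in row $j$, $0$ elsewhere. $I_A=\langle\mathbf{x}^{\mathbf{u}}-\mathbf{x}^{\mathbf{v}}:A\mathbf{u}=A\mathbf{v},\ \mathbf{u},\mathbf{v}\in\mathbb{N}^n\rangle\subseteq k[x_{i,j}:1\le i<j\le d]$. -}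

module Defs where

open import Level using (Level; _⊔_) renaming (suc to lsuc)
open import Algebra.Bundles using (CommutativeRing)
open import Data.Nat as ℕ using (ℕ; zero; suc; _∸_)
open import Data.Fin as Fin using (Fin; toℕ)
open import Data.Fin.Properties using (_<?_)
open import Data.Integer as ℤ using (ℤ)
open import Data.Vec as Vec using (Vec; lookup; zipWith)
open import Data.Vec.Properties using (≡-dec)
open import Data.List as List using (List; []; _∷_; _++_; concatMap; filter; allFin)
open import Data.Product using (Σ; ∃; _×_; _,_; proj₁; proj₂)
open import Relation.Nullary using (¬_; does)
open import Relation.Binary.PropositionalEquality using (_≡_)
open import Data.List.Relation.Unary.All using (All)
open import Data.Bool using (if_then_else_)
open import Data.Sum using (_⊎_)

record Field (c ℓ : Level) : Set (lsuc (c ⊔ ℓ)) where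
  field
    commutativeRing : CommutativeRing c ℓ
  open CommutativeRing commutativeRing public
  field
    0≉1     : ¬ (0# ≈ 1#)
    inverse : ∀ x → ¬ (x ≈ 0#) → Σ Carrier λ y → (x * y) ≈ 1#

-- Monomials in the variables x_{i,j}, i < j, vertices 0..d-1 (= 1..d).
-- A monomial is a d×d exponent table; entry (i , j) is the exponent of
-- x_{i,j}.  Only entries with i < j are meaningful (validity below).

Mono : ℕ → Set
Mono d = Vec (Vec ℕ d) d

ex : ∀ {d} → Mono d → Fin d → Fin d → ℕ
ex m i j = lookup (lookup m i) j

ValidMono : ∀ {d} → Mono d → Set
ValidMono {d} m = ∀ (i j : Fin d) → ¬ (i Fin.< j) → ex m i j ≡ 0

_⊕_ : ∀ {d} → Mono d → Mono d → Mono d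
m ⊕ m' = zipWith (zipWith ℕ._+_) m m'

one : ∀ {d} → Mono d
one = Vec.replicate _ (Vec.replicate _ 0)

var : ∀ {d} → Fin d → Fin d → Mono d
var {d} i j = Vec.tabulate λ a → Vec.tabulate λ b →
  if does (a Fin.≟ i) then (if does (b Fin.≟ j) then 1 else 0) else 0

_≟M_ : ∀ {d} (m m' : Mono d) → Relation.Nullary.Dec (m ≡ m')
_≟M_ = ≡-dec (≡-dec ℕ._≟_)

_∣M_ : ∀ {d} → Mono d → Mono d → Set
_∣M_ {d} m m' = ∀ (i j : Fin d) → ex m i j ℕ.≤ ex m' i j

VarGt : ∀ {d} → (Fin d × Fin d) → (Fin d × Fin d) → Set
VarGt (i , j) (k , l) =
  (toℕ j ∸ toℕ i ℕ.< toℕ l ∸ toℕ k)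
  ⊎ ((toℕ j ∸ toℕ i ≡ toℕ l ∸ toℕ k) × (toℕ i ℕ.< toℕ k))

_≻_ : ∀ {d} → Mono d → Mono d → Set
_≻_ {d} m m' = Σ (Fin d) λ i → Σ (Fin d) λ j →
  (i Fin.< j) × (ex m' i j ℕ.< ex m i j) ×
  (∀ (k l : Fin d) → k Fin.< l → VarGt (k , l) (i , j) → ex m k l ≡ ex m' k l)

sumFin : ∀ {n} → (Fin n → ℤ) → ℤ
sumFin {zero}  f = ℤ.0ℤ
sumFin {suc n} f = f Fin.zero ℤ.+ sumFin (λ i → f (Fin.suc i))

incidence : ∀ {d} → Fin d → Fin d → Fin d → ℤ
incidence r i j =
  if does (r Fin.≟ i) then ℤ.1ℤ else (if does (r Fin.≟ j) then ℤ.-1ℤ else ℤ.0ℤ)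

Amul : ∀ {d} → Mono d → Fin d → ℤ
Amul {d} u r = sumFin λ i → sumFin λ j →
  if does (i <? j) then incidence r i j ℤ.* ℤ.+ (ex u i j) else ℤ.0ℤ

module Poly {c ℓ} (K : Field c ℓ) (d : ℕ) where
  open Field K

  Pol : Set c
  Pol = List (Carrier × Mono d)

  ValidPol : Pol → Set c
  ValidPol f = All (λ t → ValidMono (proj₂ t)) f

  coeff : Pol → Mono d → Carrier
  coeff []            m = 0#
  coeff ((a , m') ∷ f) m = if does (m' ≟M m) then a + coeff f m else coeff f m

  _≈P_ : Pol → Pol → Set ℓ
  f ≈P g = ∀ m → coeff f m ≈ coeff g m

  mon : Mono d → Pol
  mon m = (1# , m) ∷ []

  _+P_ : Pol → Pol → Pol
  _+P_ = _++_

  -P_ : Pol → Pol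
  -P f = List.map (λ t → (- proj₁ t , proj₂ t)) f

  _-P_ : Pol → Pol → Pol
  f -P g = f +P (-P g)

  _*P_ : Pol → Pol → Pol
  f *P g = concatMap (λ t → List.map (λ s → (proj₁ t * proj₁ s , proj₂ t ⊕ proj₂ s)) g) f

  sumP : List Pol → Pol
  sumP = List.foldr _+P_ []

  binom : Mono d → Mono d → Pol
  binom u v = mon u -P mon v

  -- I_A : the ideal of k[x_{i,j} : i<j] generated by all x^u - x^v with
  -- A u = A v (u, v ∈ ℕ^n); membership = being a finite combination.
  record Generator : Set c where
    field
      cof   : Pol
      cofOK : ValidPol cof
      u v   : Mono d
      uOK   : ValidMono u
      vOK   : ValidMono v
      Au≡Av : ∀ r → Amul u r ≡ Amul v r

  InIA : Pol → Set (c ⊔ ℓ)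
  InIA f = ValidPol f × Σ (List Generator) λ gs →
    f ≈P sumP (List.map (λ g → Generator.cof g *P binom (Generator.u g) (Generator.v g)) gs)

  -- m is the leading monomial of f w.r.t. ≻ (f ≠ 0 is implied)
  IsLM : Pol → Mono d → Set ℓ
  IsLM f m = ¬ (coeff f m ≈ 0#) × (∀ m' → ValidMono m' → m' ≻ m → coeff f m' ≈ 0#)

  record IsReducedGB (G : List Pol) : Set (c ⊔ ℓ) where
    field
      inIdeal  : ∀ p → InIA (List.lookup G p)
      monic    : ∀ p → Σ (Mono d) λ m → IsLM (List.lookup G p) m × coeff (List.lookup G p) m ≈ 1#
      -- ⟨LT(I_A)⟩ = ⟨LT(G)⟩: every leading monomial of a nonzero element
      -- of I_A is divisible by the leading monomial of some element of G
      gröbner  : ∀ f m → InIA f → IsLM f m →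
                 Σ (Fin (List.length G)) λ p → Σ (Mono d) λ mp →
                   IsLM (List.lookup G p) mp × (mp ∣M m)
      -- no monomial of g ∈ G lies in ⟨LT(G ∖ {g})⟩
      reduced  : ∀ p q → ¬ (p ≡ q) → ∀ m mq → ¬ (coeff (List.lookup G p) m ≈ 0#) →
                 IsLM (List.lookup G q) mq → ¬ (mq ∣M m)

  triples : List (Fin d × Fin d × Fin d)
  triples = filter (λ t → proj₁ t <? proj₁ (proj₂ t))
              (filter (λ t → proj₁ (proj₂ t) <? proj₂ (proj₂ t))
                (concatMap (λ i → concatMap (λ j → List.map (λ k → (i , j , k)) (allFin d)) (allFin d)) (allFin d)))

  quadruples : List (Fin d × Fin d × Fin d × Fin d)
  quadruples = concatMap (λ t → List.map (λ l → (proj₁ t , proj₁ (proj₂ t) , proj₂ (proj₂ t) , l))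
                                  (filter (λ l → proj₂ (proj₂ t) <? l) (allFin d))) triples

  G₁ : List Pol
  G₁ = List.map (λ t → let i = proj₁ t ; j = proj₁ (proj₂ t) ; k = proj₂ (proj₂ t) in
                   binom (var i j ⊕ var j k) (var i k)) triples

  G₂ : List Pol
  G₂ = List.map (λ q → let i = proj₁ q ; j = proj₁ (proj₂ q) ; k = proj₁ (proj₂ (proj₂ q)) ; l = proj₂ (proj₂ (proj₂ q)) in
                   binom (var i l ⊕ var j k) (var i k ⊕ var j l)) quadruples

  basis : List Pol
  basis = G₁ ++ G₂

-- Read a monomial as a multiset of arcs of G_d; A sends it to out-degree minus in-degree
-- at every vertex. Call it standard if no leading term x_{ij}x_{jk} or x_{il}x_{jk}
-- (i<j<k<l) divides it: no vertex has both entering and leaving arcs and no two arcs are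
-- nested. Such an arc system is determined by its degrees, since the arc leaving the
-- smallest tail enters the smallest head; so a fibre of A holds at most one standard
-- monomial. Replacing a leading term by its trailing term stays in the fibre and goes
-- down both in ≻ and in the weight Σ e_{ij} (d² + (j−i)²), so every fibre does contain a
-- standard monomial, and it is the ≻-least element of the fibre. Every element of I_A has
-- coefficient sum zero on each fibre, so its leading monomial cannot be standard, i.e. it
-- is divisible by a leading term of the basis.

{-# OPTIONS --safe #-}
module Submission where

open import Defs
open import Level using (Level)
open import Algebra.Bundles using (CommutativeMonoid)
open import Data.Bool using (Bool; true; false; if_then_else_)
open import Data.Empty using (⊥-elim)
open import Data.Fin as Fin using (Fin; toℕ; zero; suc)
import Data.Fin.Properties as Finₚ
open import Data.Integer as ℤ using (ℤ; 0ℤ; 1ℤ) renaming (+_ to pos; _+_ to _+ℤ_; _*_ to _*ℤ_)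
import Data.Integer.Properties as ℤₚ
open import Data.List as List using (List; []; _∷_; _++_; length; lookup)
open import Data.List.Relation.Unary.All as All using ([]; _∷_)
import Data.List.Relation.Unary.All.Properties as Allₚ
open import Data.List.Relation.Unary.AllPairs as AllPairs using ([]; _∷_)
import Data.List.Relation.Unary.AllPairs.Properties as AllPairsₚ
open import Data.List.Relation.Unary.Unique.Propositional using (Unique)
import Data.List.Relation.Unary.Unique.Propositional.Properties as Uniqueₚ
open import Data.List.Relation.Binary.Disjoint.Propositional using (Disjoint)
open import Data.List.Membership.Propositional using (_∈_; find; lose)
import Data.List.Relation.Unary.Any as Any
import Data.List.Relation.Unary.Any.Properties as Anyₚ
open import Data.List.Membership.Propositional.Properties
  using ( ∈-lookup; ∈-map⁺; ∈-map⁻; ∈-++⁺ˡ; ∈-++⁺ʳ; ∈-++⁻; ∈-concatMap⁺; ∈-concatMap⁻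
        ; ∈-filter⁺; ∈-filter⁻; ∈-allFin)
import Data.List.Properties as Listₚ
open import Data.Nat as ℕ using (ℕ; zero; suc; _+_; _*_; _∸_; _≤_; _<_; z≤n; s≤s)
open import Data.Nat.Combinatorics using (_C_; nC1≡n; nCk+nC[k+1]≡[n+1]C[k+1])
import Data.Nat.Properties as ℕₚ
open import Data.Product using (Σ; ∃; _×_; _,_; proj₁; proj₂)
open import Data.Sum using (_⊎_; inj₁; inj₂)
import Data.Sum.Properties as Sumₚ
import Data.Vec as Vec
import Data.Vec.Properties as Vecₚ
open import Function using (_∘_)
open import Relation.Binary using (tri<; tri≈; tri>)
open import Relation.Binary.PropositionalEquality
  using (_≡_; _≢_; refl; sym; trans; cong; cong₂; subst; subst₂; module ≡-Reasoning)
open import Relation.Nullary using (¬_; Dec; yes; no; does)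
open import Relation.Nullary.Decidable using (dec-true; dec-false; does-⇔; _×-dec_; _→-dec_; ¬?)
open import Function.Bundles using (_⇔_; mk⇔)
import Relation.Binary.Reasoning.Setoid
import Algebra.Properties.CommutativeSemigroup as CommSemigroupₚ
open import Data.Nat.Solver using (module +-*-Solver)
open +-*-Solver using (solve; _:=_; _:+_; _:*_; con)

private
  variable
    d : ℕ

module FinSum {a ℓ} (M : CommutativeMonoid a ℓ) where
  open CommutativeMonoid M
    using (Carrier; _≈_; ∙-congˡ; ∙-congʳ; identityˡ; identityʳ)
    renaming (ε to 0#; trans to ≈-trans)
  open import Algebra.Properties.CommutativeMonoid.Sum M public
    using (sum; sum-cong-≗; ∑-distrib-+)
  open import Algebra.Properties.CommutativeMonoid.Sum M
    using (sum-cong-≋; sum-replicate-zero)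

  sum-zero : ∀ {n} (f : Fin n → Carrier) → (∀ i → f i ≈ 0#) → sum f ≈ 0#
  sum-zero {n} f f≈0 = ≈-trans (sum-cong-≋ f≈0) (sum-replicate-zero n)

  sum-single : ∀ {n} (f : Fin n → Carrier) j → (∀ i → i ≢ j → f i ≈ 0#) → sum f ≈ f j
  sum-single f zero f≈0 =
    ≈-trans (∙-congˡ (sum-zero (f ∘ suc) λ i → f≈0 (suc i) λ ())) (identityʳ (f zero))
  sum-single f (suc j) f≈0 =
    ≈-trans (∙-congʳ (f≈0 zero λ ()))
            (≈-trans (identityˡ _)
                     (sum-single (f ∘ suc) j λ i i≢j → f≈0 (suc i) (i≢j ∘ Finₚ.suc-injective)))

module ℕ-sum = FinSum ℕₚ.+-0-commutativeMonoid
module ℤ-sum = FinSum ℤₚ.+-0-commutativeMonoid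
open ℕ-sum using (sum; sum-cong-≗; ∑-distrib-+; sum-zero; sum-single)

term≤sum : ∀ {n} (f : Fin n → ℕ) i → f i ≤ sum f
term≤sum f zero    = ℕₚ.m≤m+n _ _
term≤sum f (suc i) = ℕₚ.≤-trans (term≤sum (f ∘ suc) i) (ℕₚ.m≤n+m _ _)

positive-term : ∀ {n} (f : Fin n → ℕ) → 0 < sum f → ∃ λ i → 0 < f i
positive-term {suc n} f 0<sum with f zero in eq
... | suc _ = zero , subst (0 <_) (sym eq) (s≤s z≤n)
... | zero with positive-term (f ∘ suc) 0<sum
...   | i , 0<fi = suc i , 0<fi

sum-pos : ∀ {n} (f : Fin n → ℕ) → ℤ-sum.sum (λ i → pos (f i)) ≡ pos (sum f)
sum-pos {zero}  f = refl
sum-pos {suc n} f = trans (cong (pos (f zero) +ℤ_) (sum-pos (f ∘ suc))) (sym (ℤₚ.pos-+ (f zero) _))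

ex-⊕ : ∀ (m m' : Mono d) i j → ex (m ⊕ m') i j ≡ ex m i j + ex m' i j
ex-⊕ m m' i j = trans (cong (λ row → Vec.lookup row j) (Vecₚ.lookup-zipWith (Vec.zipWith _+_) i m m'))
                      (Vecₚ.lookup-zipWith _+_ j (Vec.lookup m i) (Vec.lookup m' i))

monomial : (Fin d → Fin d → ℕ) → Mono d
monomial e = Vec.tabulate λ i → Vec.tabulate λ j → e i j

ex-monomial : ∀ (e : Fin d → Fin d → ℕ) i j → ex (monomial e) i j ≡ e i j
ex-monomial e i j = trans (cong (λ row → Vec.lookup row j) (Vecₚ.lookup∘tabulate _ i))
                          (Vecₚ.lookup∘tabulate _ j)

monomial-ex : ∀ (m : Mono d) → monomial (ex m) ≡ m
monomial-ex m = trans (Vecₚ.tabulate-cong λ i → Vecₚ.tabulate∘lookup (Vec.lookup m i))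
                      (Vecₚ.tabulate∘lookup m)

mono-ext : ∀ {m m' : Mono d} → (∀ i j → ex m i j ≡ ex m' i j) → m ≡ m'
mono-ext {m = m} {m'} e = begin
  m                  ≡⟨ monomial-ex m ⟨
  monomial (ex m)    ≡⟨ Vecₚ.tabulate-cong (λ i → Vecₚ.tabulate-cong (e i)) ⟩
  monomial (ex m')   ≡⟨ monomial-ex m' ⟩
  m'                 ∎
  where open ≡-Reasoning

ex-one : ∀ (i j : Fin d) → ex one i j ≡ 0
ex-one i j = trans (cong (λ row → Vec.lookup row j) (Vecₚ.lookup-replicate i _))
                   (Vecₚ.lookup-replicate j 0)

one-⊕ : ∀ (m : Mono d) → one ⊕ m ≡ m
one-⊕ m = mono-ext λ i j → trans (ex-⊕ one m i j) (cong (_+ ex m i j) (ex-one i j))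

ex-var : ∀ (i j a b : Fin d) →
         ex (var i j) a b ≡ (if does (a Fin.≟ i) then (if does (b Fin.≟ j) then 1 else 0) else 0)
ex-var i j = ex-monomial _

ex-var-≡ : ∀ (i j : Fin d) → ex (var i j) i j ≡ 1
ex-var-≡ i j rewrite ex-var i j i j | dec-true (i Fin.≟ i) refl | dec-true (j Fin.≟ j) refl = refl

ex-var-≢ : ∀ (i j a b : Fin d) → ¬ (a ≡ i × b ≡ j) → ex (var i j) a b ≡ 0
ex-var-≢ i j a b ≢ij rewrite ex-var i j a b with a Fin.≟ i | b Fin.≟ j
... | yes a≡i | yes b≡j = ⊥-elim (≢ij (a≡i , b≡j))
... | yes _   | no _    = refl
... | no _    | _       = refl

ex-var-pos : ∀ (i j a b : Fin d) → 0 < ex (var i j) a b → a ≡ i × b ≡ j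
ex-var-pos i j a b 0<e with a Fin.≟ i | b Fin.≟ j
... | yes a≡i | yes b≡j = a≡i , b≡j
... | no a≢i  | _       = ⊥-elim (ℕₚ.<⇒≢ 0<e (sym (ex-var-≢ i j a b (a≢i ∘ proj₁))))
... | yes _   | no b≢j  = ⊥-elim (ℕₚ.<⇒≢ 0<e (sym (ex-var-≢ i j a b (b≢j ∘ proj₂))))

ex-var⊕var-pos : ∀ (i j k l a b : Fin d) → 0 < ex (var i j ⊕ var k l) a b →
                 (a ≡ i × b ≡ j) ⊎ (a ≡ k × b ≡ l)
ex-var⊕var-pos i j k l a b 0<e with ex (var i j) a b in eq
... | suc _ = inj₁ (ex-var-pos i j a b (subst (0 <_) (sym eq) (s≤s z≤n)))
... | zero  = inj₂ (ex-var-pos k l a b (subst (0 <_) (trans (ex-⊕ (var i j) (var k l) a b) (cong (_+ _) eq)) 0<e))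

0<ex-var : ∀ (i j : Fin d) → 0 < ex (var i j) i j
0<ex-var i j = subst (0 <_) (sym (ex-var-≡ i j)) (s≤s z≤n)

0<ex-⊕ˡ : ∀ (m m' : Mono d) i j → 0 < ex m i j → 0 < ex (m ⊕ m') i j
0<ex-⊕ˡ m m' i j 0<e = subst (0 <_) (sym (ex-⊕ m m' i j)) (ℕₚ.<-≤-trans 0<e (ℕₚ.m≤m+n _ _))

0<ex-⊕ʳ : ∀ (m m' : Mono d) i j → 0 < ex m' i j → 0 < ex (m ⊕ m') i j
0<ex-⊕ʳ m m' i j 0<e = subst (0 <_) (sym (ex-⊕ m m' i j)) (ℕₚ.<-≤-trans 0<e (ℕₚ.m≤n+m _ _))

_∸M_ : Mono d → Mono d → Mono d
m ∸M m' = monomial λ i j → ex m i j ∸ ex m' i j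

∣M⇒≡∸M⊕ : ∀ (m m' : Mono d) → m' ∣M m → m ≡ (m ∸M m') ⊕ m'
∣M⇒≡∸M⊕ m m' m'∣m = mono-ext λ i j → sym (begin
  ex ((m ∸M m') ⊕ m') i j           ≡⟨ ex-⊕ (m ∸M m') m' i j ⟩
  ex (m ∸M m') i j + ex m' i j      ≡⟨ cong (_+ ex m' i j) (ex-monomial _ i j) ⟩
  ex m i j ∸ ex m' i j + ex m' i j  ≡⟨ ℕₚ.m∸n+n≡m (m'∣m i j) ⟩
  ex m i j                          ∎)
  where open ≡-Reasoning

∸M-∣M : ∀ (m m' : Mono d) → (m ∸M m') ∣M m
∸M-∣M m m' i j = subst (_≤ ex m i j) (sym (ex-monomial _ i j)) (ℕₚ.m∸n≤m (ex m i j) (ex m' i j))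

∣M-reflexive : ∀ {m m' : Mono d} → m ≡ m' → m ∣M m'
∣M-reflexive refl i j = ℕₚ.≤-refl

∣M-trans : ∀ (m₁ m₂ m₃ : Mono d) → m₁ ∣M m₂ → m₂ ∣M m₃ → m₁ ∣M m₃
∣M-trans _ _ _ m₁∣m₂ m₂∣m₃ i j = ℕₚ.≤-trans (m₁∣m₂ i j) (m₂∣m₃ i j)

∣M⇒ex-pos : ∀ {m m' : Mono d} i j → m' ∣M m → 0 < ex m' i j → 0 < ex m i j
∣M⇒ex-pos i j m'∣m 0<e = ℕₚ.<-≤-trans 0<e (m'∣m i j)

var-∣M : ∀ (m : Mono d) i j → 0 < ex m i j → var i j ∣M m
var-∣M m i j 0<e a b with ex (var i j) a b in eq
... | zero  = z≤n
... | suc _ with ex-var-pos i j a b (subst (0 <_) (sym eq) (s≤s z≤n))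
...   | refl , refl = subst (_≤ ex m i j) (trans (sym (ex-var-≡ i j)) eq) 0<e

var⊕var-∣M : ∀ (m : Mono d) i j k l → ¬ (i ≡ k × j ≡ l) →
             0 < ex m i j → 0 < ex m k l → (var i j ⊕ var k l) ∣M m
var⊕var-∣M m i j k l ≢ 0<eij 0<ekl a b
  rewrite ex-⊕ (var i j) (var k l) a b
  with (a Fin.≟ i) ×-dec (b Fin.≟ j) | (a Fin.≟ k) ×-dec (b Fin.≟ l)
... | yes (refl , refl) | yes (refl , refl) = ⊥-elim (≢ (refl , refl))
... | yes (refl , refl) | no ≢kl =
  subst (_≤ ex m i j) (sym (cong₂ _+_ (ex-var-≡ i j) (ex-var-≢ k l i j ≢kl))) 0<eij
... | no ≢ij | yes (refl , refl) =
  subst (_≤ ex m k l) (sym (cong₂ _+_ (ex-var-≢ i j k l ≢ij) (ex-var-≡ k l))) 0<ekl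
... | no ≢ij | no ≢kl =
  subst (_≤ ex m a b) (sym (cong₂ _+_ (ex-var-≢ i j a b ≢ij) (ex-var-≢ k l a b ≢kl))) z≤n

var⊕var-∣M⇒ : ∀ {m : Mono d} i j k l → (var i j ⊕ var k l) ∣M m → 0 < ex m i j × 0 < ex m k l
var⊕var-∣M⇒ {m = m} i j k l ∣m =
  ∣M⇒ex-pos {m = m} {var i j ⊕ var k l} i j ∣m (0<ex-⊕ˡ (var i j) (var k l) i j (0<ex-var i j)) ,
  ∣M⇒ex-pos {m = m} {var i j ⊕ var k l} k l ∣m (0<ex-⊕ʳ (var i j) (var k l) k l (0<ex-var k l))

valid-var : ∀ {i j : Fin d} → i Fin.< j → ValidMono (var i j)
valid-var i<j a b a≮b = ex-var-≢ _ _ a b λ { (refl , refl) → a≮b i<j }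

valid-⊕ : ∀ (m m' : Mono d) → ValidMono m → ValidMono m' → ValidMono (m ⊕ m')
valid-⊕ m m' vm vm' a b a≮b = trans (ex-⊕ m m' a b) (cong₂ _+_ (vm a b a≮b) (vm' a b a≮b))

valid-∣M : ∀ (m' m : Mono d) → m' ∣M m → ValidMono m → ValidMono m'
valid-∣M m' m m'∣m vm a b a≮b = ℕₚ.n≤0⇒n≡0 (subst (_ ≤_) (vm a b a≮b) (m'∣m a b))

valid-∸M : ∀ (m m' : Mono d) → ValidMono m → ValidMono (m ∸M m')
valid-∸M m m' = valid-∣M (m ∸M m') m (∸M-∣M m m')

valid-one : ValidMono {d} one
valid-one i j _ = ex-one i j

valid-pos : ∀ (m : Mono d) → ValidMono m → ∀ a b → 0 < ex m a b → a Fin.< b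
valid-pos m vm a b 0<e with a Fin.<? b
... | yes a<b = a<b
... | no a≮b  = ⊥-elim (ℕₚ.<⇒≢ 0<e (sym (vm a b a≮b)))

span : Fin d → Fin d → ℕ
span i j = toℕ j ∸ toℕ i

span-+ : ∀ {i j k : Fin d} → i Fin.≤ j → j Fin.≤ k → span i k ≡ span i j + span j k
span-+ {i = i} {j} {k} i≤j j≤k = ℕₚ.+-cancelʳ-≡ (toℕ i) _ _ (begin
  span i k + toℕ i                ≡⟨ ℕₚ.m∸n+n≡m (ℕₚ.≤-trans i≤j j≤k) ⟩
  toℕ k                           ≡⟨ ℕₚ.m∸n+n≡m j≤k ⟨
  span j k + toℕ j                ≡⟨ cong (span j k +_) (ℕₚ.m∸n+n≡m i≤j) ⟨
  span j k + (span i j + toℕ i)   ≡⟨ ℕₚ.+-assoc (span j k) _ _ ⟨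
  span j k + span i j + toℕ i     ≡⟨ cong (_+ toℕ i) (ℕₚ.+-comm (span j k) _) ⟩
  span i j + span j k + toℕ i     ∎)
  where open ≡-Reasoning

span-<ʳ : ∀ {i j k : Fin d} → i Fin.< j → j Fin.< k → span i j < span i k
span-<ʳ i<j j<k = ℕₚ.∸-monoˡ-< j<k (ℕₚ.<⇒≤ i<j)

span-<ˡ : ∀ {i j k : Fin d} → i Fin.< j → j Fin.< k → span j k < span i k
span-<ˡ i<j j<k = ℕₚ.∸-monoʳ-< i<j (ℕₚ.<⇒≤ j<k)

VarGt-irrefl : ∀ {p : Fin d × Fin d} → ¬ VarGt p p
VarGt-irrefl (inj₁ lt)      = ℕₚ.<-irrefl refl lt
VarGt-irrefl (inj₂ (_ , lt)) = ℕₚ.<-irrefl refl lt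

VarGt-trans : ∀ {p q r : Fin d × Fin d} → VarGt p q → VarGt q r → VarGt p r
VarGt-trans (inj₁ lt)       (inj₁ lt')        = inj₁ (ℕₚ.<-trans lt lt')
VarGt-trans (inj₁ lt)       (inj₂ (eq , _))   = inj₁ (ℕₚ.<-≤-trans lt (ℕₚ.≤-reflexive eq))
VarGt-trans (inj₂ (eq , _)) (inj₁ lt)         = inj₁ (ℕₚ.≤-<-trans (ℕₚ.≤-reflexive eq) lt)
VarGt-trans (inj₂ (eq , lt)) (inj₂ (eq' , lt')) = inj₂ (trans eq eq' , ℕₚ.<-trans lt lt')

VarGt-asym : ∀ {p q : Fin d × Fin d} → VarGt p q → ¬ VarGt q p
VarGt-asym p>q q>p = VarGt-irrefl (VarGt-trans p>q q>p)

span>⇒¬VarGt : ∀ {p q : Fin d × Fin d} →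
               span (proj₁ q) (proj₂ q) < span (proj₁ p) (proj₂ p) → ¬ VarGt p q
span>⇒¬VarGt lt (inj₁ lt')      = ℕₚ.<-asym lt lt'
span>⇒¬VarGt lt (inj₂ (eq , _)) = ℕₚ.<-irrefl (sym eq) lt

VarGt-trichotomy : ∀ {i j k l : Fin d} → i Fin.< j → k Fin.< l →
                   VarGt (i , j) (k , l) ⊎ ((i , j) ≡ (k , l)) ⊎ VarGt (k , l) (i , j)
VarGt-trichotomy {i = i} {j} {k} {l} i<j k<l with ℕₚ.<-cmp (span i j) (span k l)
... | tri< lt _ _ = inj₁ (inj₁ lt)
... | tri> _ _ gt = inj₂ (inj₂ (inj₁ gt))
... | tri≈ _ eq _ with ℕₚ.<-cmp (toℕ i) (toℕ k)
...   | tri< lt _ _  = inj₁ (inj₂ (eq , lt))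
...   | tri> _ _ gt  = inj₂ (inj₂ (inj₂ (sym eq , gt)))
...   | tri≈ _ eq' _ = inj₂ (inj₁ (cong₂ _,_ (Finₚ.toℕ-injective eq') (Finₚ.toℕ-injective (begin
  toℕ j             ≡⟨ ℕₚ.m∸n+n≡m (ℕₚ.<⇒≤ i<j) ⟨
  span i j + toℕ i  ≡⟨ cong₂ _+_ eq eq' ⟩
  span k l + toℕ k  ≡⟨ ℕₚ.m∸n+n≡m (ℕₚ.<⇒≤ k<l) ⟩
  toℕ l             ∎))))
  where open ≡-Reasoning

≻-irrefl : ∀ (m : Mono d) → ¬ (m ≻ m)
≻-irrefl m (_ , _ , _ , lt , _) = ℕₚ.<-irrefl refl lt

≻-trans : ∀ {m₁ m₂ m₃ : Mono d} → m₁ ≻ m₂ → m₂ ≻ m₃ → m₁ ≻ m₃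
≻-trans {m₁ = m₁} {m₂} {m₃} (i , j , i<j , lt , above) (k , l , k<l , lt' , above')
  with VarGt-trichotomy i<j k<l
... | inj₁ ij>kl =
  i , j , i<j , subst (_< ex m₁ i j) (above' i j i<j ij>kl) lt ,
  λ a b a<b ab>ij → trans (above a b a<b ab>ij) (above' a b a<b (VarGt-trans ab>ij ij>kl))
... | inj₂ (inj₁ refl) =
  i , j , i<j , ℕₚ.<-trans lt' lt ,
  λ a b a<b ab>ij → trans (above a b a<b ab>ij) (above' a b a<b ab>ij)
... | inj₂ (inj₂ kl>ij) =
  k , l , k<l , subst (ex m₃ k l <_) (sym (above k l k<l kl>ij)) lt' ,
  λ a b a<b ab>kl → trans (above a b a<b (VarGt-trans ab>kl kl>ij)) (above' a b a<b ab>kl)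

≻-asym : ∀ {m₁ m₂ : Mono d} → m₁ ≻ m₂ → ¬ (m₂ ≻ m₁)
≻-asym {m₁ = m₁} {m₂} m₁≻m₂ m₂≻m₁ =
  ≻-irrefl m₁ (≻-trans {m₁ = m₁} {m₂} {m₁} m₁≻m₂ m₂≻m₁)

⊕-monoʳ-≻ : ∀ (m : Mono d) {m₁ m₂} → m₁ ≻ m₂ → (m ⊕ m₁) ≻ (m ⊕ m₂)
⊕-monoʳ-≻ m {m₁} {m₂} (i , j , i<j , lt , above) =
  i , j , i<j ,
  subst₂ _<_ (sym (ex-⊕ m m₂ i j)) (sym (ex-⊕ m m₁ i j)) (ℕₚ.+-monoʳ-< (ex m i j) lt) ,
  λ a b a<b ab>ij → trans (ex-⊕ m m₁ a b)
                   (trans (cong (ex m a b +_) (above a b a<b ab>ij)) (sym (ex-⊕ m m₂ a b)))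

NoVarAbove : Fin d × Fin d → Mono d → Set
NoVarAbove w m = ∀ a b → VarGt (a , b) w → ex m a b ≡ 0

var-NoVarAbove : ∀ {w : Fin d × Fin d} {a b} → ¬ VarGt (a , b) w → NoVarAbove w (var a b)
var-NoVarAbove ¬ab>w k l kl>w = ex-var-≢ _ _ k l λ { (refl , refl) → ¬ab>w kl>w }

⊕-NoVarAbove : ∀ {w : Fin d × Fin d} {m m'} → NoVarAbove w m → NoVarAbove w m' → NoVarAbove w (m ⊕ m')
⊕-NoVarAbove {m = m} {m'} none none' a b ab>w =
  trans (ex-⊕ m m' a b) (cong₂ _+_ (none a b ab>w) (none' a b ab>w))

≻-by-top-var : ∀ {m m' : Mono d} {i j} → i Fin.< j → NoVarAbove (i , j) m → NoVarAbove (i , j) m' →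
               ex m' i j < ex m i j → m ≻ m'
≻-by-top-var {i = i} {j} i<j none none' lt =
  i , j , i<j , lt , λ a b _ ab>ij → trans (none a b ab>ij) (sym (none' a b ab>ij))

path : Fin d → Fin d → Fin d → Mono d
path i j k = var i j ⊕ var j k

nested crossing : Fin d → Fin d → Fin d → Fin d → Mono d
nested   i j k l = var i l ⊕ var j k
crossing i j k l = var i k ⊕ var j l

-- Longer arcs are smaller variables, so the top variable of a leading term is absent
-- from its trailing term.
path≻shortcut : ∀ {i j k : Fin d} → i Fin.< j → j Fin.< k → path i j k ≻ var i k
path≻shortcut {i = i} {j} {k} i<j j<k with VarGt-trichotomy i<j j<k
... | inj₁ ij>jk = ≻-by-top-var {m = path i j k} {m' = var i k} i<j
  (⊕-NoVarAbove {m = var i j} {var j k} (var-NoVarAbove VarGt-irrefl) (var-NoVarAbove (VarGt-asym ij>jk)))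
  (var-NoVarAbove (span>⇒¬VarGt (span-<ʳ i<j j<k)))
  (subst (_< ex (path i j k) i j) (sym (ex-var-≢ i k i j λ (_ , j≡k) → Finₚ.<⇒≢ j<k j≡k))
         (0<ex-⊕ˡ (var i j) (var j k) i j (0<ex-var i j)))
... | inj₂ (inj₁ ij≡jk) = ⊥-elim (Finₚ.<⇒≢ i<j (cong proj₁ ij≡jk))
... | inj₂ (inj₂ jk>ij) = ≻-by-top-var {m = path i j k} {m' = var i k} j<k
  (⊕-NoVarAbove {m = var i j} {var j k} (var-NoVarAbove (VarGt-asym jk>ij)) (var-NoVarAbove VarGt-irrefl))
  (var-NoVarAbove (span>⇒¬VarGt (span-<ˡ i<j j<k)))
  (subst (_< ex (path i j k) j k) (sym (ex-var-≢ i k j k λ (j≡i , _) → Finₚ.<⇒≢ i<j (sym j≡i)))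
         (0<ex-⊕ʳ (var i j) (var j k) j k (0<ex-var j k)))

nested≻crossing : ∀ {i j k l : Fin d} → i Fin.< j → j Fin.< k → k Fin.< l →
                  nested i j k l ≻ crossing i j k l
nested≻crossing {i = i} {j} {k} {l} i<j j<k k<l =
  ≻-by-top-var {m = nested i j k l} {m' = crossing i j k l} j<k
  (⊕-NoVarAbove {m = var i l} {var j k}
     (var-NoVarAbove (span>⇒¬VarGt (ℕₚ.<-trans (span-<ˡ i<j j<k) (span-<ʳ (Finₚ.<-trans i<j j<k) k<l))))
     (var-NoVarAbove VarGt-irrefl))
  (⊕-NoVarAbove {m = var i k} {var j l}
     (var-NoVarAbove (span>⇒¬VarGt (span-<ˡ i<j j<k)))
     (var-NoVarAbove (span>⇒¬VarGt (span-<ʳ j<k k<l))))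
  (subst (_< ex (nested i j k l) j k)
         (sym (trans (ex-⊕ (var i k) (var j l) j k)
                     (cong₂ _+_ (ex-var-≢ i k j k λ (j≡i , _) → Finₚ.<⇒≢ i<j (sym j≡i))
                                (ex-var-≢ j l j k λ (_ , k≡l) → Finₚ.<⇒≢ k<l k≡l))))
         (0<ex-⊕ʳ (var i l) (var j k) j k (0<ex-var j k)))

Key : ℕ → Set
Key d = (Fin d × Fin d × Fin d) ⊎ (Fin d × Fin d × Fin d × Fin d)

Increasing : Key d → Set
Increasing (inj₁ (i , j , k))     = i Fin.< j × j Fin.< k
Increasing (inj₂ (i , j , k , l)) = i Fin.< j × j Fin.< k × k Fin.< l

lead trail : Key d → Mono d
lead  (inj₁ (i , j , k))     = path i j k
lead  (inj₂ (i , j , k , l)) = nested i j k l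
trail (inj₁ (i , j , k))     = var i k
trail (inj₂ (i , j , k , l)) = crossing i j k l

lead≻trail : ∀ (x : Key d) → Increasing x → lead x ≻ trail x
lead≻trail (inj₁ _) (i<j , j<k)       = path≻shortcut i<j j<k
lead≻trail (inj₂ _) (i<j , j<k , k<l) = nested≻crossing i<j j<k k<l

sumFin≡sum : ∀ {n} (f : Fin n → ℤ) → sumFin f ≡ ℤ-sum.sum f
sumFin≡sum {zero}  f = refl
sumFin≡sum {suc n} f = cong (f zero +ℤ_) (sumFin≡sum (f ∘ suc))

arcTerm : Mono d → Fin d → Fin d → Fin d → ℤ
arcTerm m r i j = if does (i Fin.<? j) then incidence r i j *ℤ pos (ex m i j) else 0ℤ

arcTerm-≮ : ∀ (m : Mono d) r {i j} → ¬ (i Fin.< j) → arcTerm m r i j ≡ 0ℤ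
arcTerm-≮ m r {i} {j} i≮j =
  cong (if_then incidence r i j *ℤ pos (ex m i j) else 0ℤ) (dec-false (i Fin.<? j) i≮j)

arcTerm-< : ∀ (m : Mono d) r {i j} → i Fin.< j → arcTerm m r i j ≡ incidence r i j *ℤ pos (ex m i j)
arcTerm-< m r {i} {j} i<j =
  cong (if_then incidence r i j *ℤ pos (ex m i j) else 0ℤ) (dec-true (i Fin.<? j) i<j)

Amul≡sum : ∀ (m : Mono d) r → Amul m r ≡ ℤ-sum.sum λ i → ℤ-sum.sum λ j → arcTerm m r i j
Amul≡sum m r =
  trans (sumFin≡sum (λ i → sumFin (arcTerm m r i))) (ℤ-sum.sum-cong-≗ λ i → sumFin≡sum (arcTerm m r i))

arcTerm-⊕ : ∀ (m m' : Mono d) r i j → arcTerm (m ⊕ m') r i j ≡ arcTerm m r i j +ℤ arcTerm m' r i j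
arcTerm-⊕ m m' r i j with does (i Fin.<? j)
... | false = refl
... | true  = begin
  incidence r i j *ℤ pos (ex (m ⊕ m') i j)
    ≡⟨ cong (λ e → incidence r i j *ℤ pos e) (ex-⊕ m m' i j) ⟩
  incidence r i j *ℤ pos (ex m i j + ex m' i j)
    ≡⟨ cong (incidence r i j *ℤ_) (ℤₚ.pos-+ (ex m i j) (ex m' i j)) ⟩
  incidence r i j *ℤ (pos (ex m i j) +ℤ pos (ex m' i j))
    ≡⟨ ℤₚ.*-distribˡ-+ (incidence r i j) _ _ ⟩
  incidence r i j *ℤ pos (ex m i j) +ℤ incidence r i j *ℤ pos (ex m' i j) ∎
  where open ≡-Reasoning

Amul-⊕ : ∀ (m m' : Mono d) r → Amul (m ⊕ m') r ≡ Amul m r +ℤ Amul m' r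
Amul-⊕ m m' r = begin
  Amul (m ⊕ m') r
    ≡⟨ Amul≡sum (m ⊕ m') r ⟩
  ℤ-sum.sum (λ i → ℤ-sum.sum λ j → arcTerm (m ⊕ m') r i j)
    ≡⟨ ℤ-sum.sum-cong-≗ (λ i → trans (ℤ-sum.sum-cong-≗ (arcTerm-⊕ m m' r i))
                                     (ℤ-sum.∑-distrib-+ (arcTerm m r i) (arcTerm m' r i))) ⟩
  ℤ-sum.sum (λ i → ℤ-sum.sum (arcTerm m r i) +ℤ ℤ-sum.sum (arcTerm m' r i))
    ≡⟨ ℤ-sum.∑-distrib-+ (λ i → ℤ-sum.sum (arcTerm m r i)) (λ i → ℤ-sum.sum (arcTerm m' r i)) ⟩
  ℤ-sum.sum (λ i → ℤ-sum.sum (arcTerm m r i)) +ℤ ℤ-sum.sum (λ i → ℤ-sum.sum (arcTerm m' r i))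
    ≡⟨ cong₂ _+ℤ_ (Amul≡sum m r) (Amul≡sum m' r) ⟨
  Amul m r +ℤ Amul m' r ∎
  where open ≡-Reasoning

arcTerm-var : ∀ {i j : Fin d} r a b → ¬ (a ≡ i × b ≡ j) → arcTerm (var i j) r a b ≡ 0ℤ
arcTerm-var {i = i} {j} r a b ≢ij with does (a Fin.<? b)
... | false = refl
... | true  = trans (cong (λ e → incidence r a b *ℤ pos e) (ex-var-≢ i j a b ≢ij))
                    (ℤₚ.*-zeroʳ (incidence r a b))

Amul-var : ∀ {i j : Fin d} r → i Fin.< j → Amul (var i j) r ≡ incidence r i j
Amul-var {i = i} {j} r i<j = begin
  Amul (var i j) r
    ≡⟨ Amul≡sum (var i j) r ⟩
  ℤ-sum.sum (λ a → ℤ-sum.sum λ b → arcTerm (var i j) r a b)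
    ≡⟨ ℤ-sum.sum-single _ i (λ a a≢i → ℤ-sum.sum-zero _ λ b →
                                 arcTerm-var r a b (a≢i ∘ proj₁)) ⟩
  ℤ-sum.sum (λ b → arcTerm (var i j) r i b)
    ≡⟨ ℤ-sum.sum-single _ j (λ b b≢j → arcTerm-var r i b (b≢j ∘ proj₂)) ⟩
  arcTerm (var i j) r i j
    ≡⟨ arcTerm-< (var i j) r i<j ⟩
  incidence r i j *ℤ pos (ex (var i j) i j)
    ≡⟨ cong (λ e → incidence r i j *ℤ pos e) (ex-var-≡ i j) ⟩
  incidence r i j *ℤ 1ℤ
    ≡⟨ ℤₚ.*-identityʳ (incidence r i j) ⟩
  incidence r i j ∎
  where open ≡-Reasoning

incidence-path : ∀ {i j k : Fin d} r → i Fin.< j → j Fin.< k →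
                 incidence r i j +ℤ incidence r j k ≡ incidence r i k
incidence-path {i = i} {j} {k} r i<j j<k with r Fin.≟ i | r Fin.≟ j | r Fin.≟ k
... | yes refl | yes refl | _        = ⊥-elim (Finₚ.<-irrefl refl i<j)
... | yes refl | _        | yes refl = ⊥-elim (Finₚ.<-irrefl refl (Finₚ.<-trans i<j j<k))
... | _        | yes refl | yes refl = ⊥-elim (Finₚ.<-irrefl refl j<k)
... | yes _    | no _     | no _     = refl
... | no _     | yes _    | no _     = refl
... | no _     | no _     | yes _    = refl
... | no _     | no _     | no _     = refl

incidence-nested : ∀ {i j k l : Fin d} r → i Fin.< j → j Fin.< k → k Fin.< l →
                   incidence r i l +ℤ incidence r j k ≡ incidence r i k +ℤ incidence r j l
incidence-nested {i = i} {j} {k} {l} r i<j j<k k<l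
  with r Fin.≟ i | r Fin.≟ j | r Fin.≟ k | r Fin.≟ l
... | yes refl | yes refl | _        | _        = ⊥-elim (Finₚ.<-irrefl refl i<j)
... | yes refl | _        | yes refl | _        = ⊥-elim (Finₚ.<-irrefl refl (Finₚ.<-trans i<j j<k))
... | yes refl | _        | _        | yes refl =
  ⊥-elim (Finₚ.<-irrefl refl (Finₚ.<-trans i<j (Finₚ.<-trans j<k k<l)))
... | _        | yes refl | yes refl | _        = ⊥-elim (Finₚ.<-irrefl refl j<k)
... | _        | yes refl | _        | yes refl = ⊥-elim (Finₚ.<-irrefl refl (Finₚ.<-trans j<k k<l))
... | _        | _        | yes refl | yes refl = ⊥-elim (Finₚ.<-irrefl refl k<l)
... | yes _    | no _     | no _     | no _     = refl
... | no _     | yes _    | no _     | no _     = refl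
... | no _     | no _     | yes _    | no _     = refl
... | no _     | no _     | no _     | yes _    = refl
... | no _     | no _     | no _     | no _     = refl

SameFibre : Mono d → Mono d → Set
SameFibre m m' = ∀ r → Amul m r ≡ Amul m' r

path-SameFibre : ∀ {i j k : Fin d} → i Fin.< j → j Fin.< k → SameFibre (path i j k) (var i k)
path-SameFibre {i = i} {j} {k} i<j j<k r = begin
  Amul (path i j k) r                      ≡⟨ Amul-⊕ (var i j) (var j k) r ⟩
  Amul (var i j) r +ℤ Amul (var j k) r     ≡⟨ cong₂ _+ℤ_ (Amul-var r i<j) (Amul-var r j<k) ⟩
  incidence r i j +ℤ incidence r j k       ≡⟨ incidence-path r i<j j<k ⟩
  incidence r i k                          ≡⟨ Amul-var r (Finₚ.<-trans i<j j<k) ⟨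
  Amul (var i k) r                         ∎
  where open ≡-Reasoning

nested-SameFibre : ∀ {i j k l : Fin d} → i Fin.< j → j Fin.< k → k Fin.< l →
                   SameFibre (nested i j k l) (crossing i j k l)
nested-SameFibre {i = i} {j} {k} {l} i<j j<k k<l r = begin
  Amul (nested i j k l) r                  ≡⟨ Amul-⊕ (var i l) (var j k) r ⟩
  Amul (var i l) r +ℤ Amul (var j k) r     ≡⟨ cong₂ _+ℤ_ (Amul-var r i<l) (Amul-var r j<k) ⟩
  incidence r i l +ℤ incidence r j k       ≡⟨ incidence-nested r i<j j<k k<l ⟩
  incidence r i k +ℤ incidence r j l       ≡⟨ cong₂ _+ℤ_ (Amul-var r i<k) (Amul-var r j<l) ⟨
  Amul (var i k) r +ℤ Amul (var j l) r     ≡⟨ Amul-⊕ (var i k) (var j l) r ⟨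
  Amul (crossing i j k l) r                ∎
  where
  open ≡-Reasoning
  i<k = Finₚ.<-trans i<j j<k
  j<l = Finₚ.<-trans j<k k<l
  i<l = Finₚ.<-trans i<k k<l

lead∼trail : ∀ (x : Key d) → Increasing x → SameFibre (lead x) (trail x)
lead∼trail (inj₁ _) (i<j , j<k)       = path-SameFibre i<j j<k
lead∼trail (inj₂ _) (i<j , j<k , k<l) = nested-SameFibre i<j j<k k<l

SameFibre-⊕ˡ : ∀ (m : Mono d) {m₁ m₂} → SameFibre m₁ m₂ → SameFibre (m ⊕ m₁) (m ⊕ m₂)
SameFibre-⊕ˡ m {m₁} {m₂} m₁∼m₂ r =
  trans (Amul-⊕ m m₁ r) (trans (cong (Amul m r +ℤ_) (m₁∼m₂ r)) (sym (Amul-⊕ m m₂ r)))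

SameFibre-trans : ∀ {m₁ m₂ m₃ : Mono d} → SameFibre m₁ m₂ → SameFibre m₂ m₃ → SameFibre m₁ m₃
SameFibre-trans m₁∼m₂ m₂∼m₃ r = trans (m₁∼m₂ r) (m₂∼m₃ r)

outdeg indeg : Mono d → Fin d → ℕ
outdeg m r = sum (ex m r)
indeg  m r = sum λ a → ex m a r

degree : Mono d → ℕ
degree m = sum (outdeg m)

outdeg-⊕ : ∀ (m m' : Mono d) r → outdeg (m ⊕ m') r ≡ outdeg m r + outdeg m' r
outdeg-⊕ m m' r = trans (sum-cong-≗ (ex-⊕ m m' r)) (∑-distrib-+ (ex m r) (ex m' r))

indeg-⊕ : ∀ (m m' : Mono d) r → indeg (m ⊕ m') r ≡ indeg m r + indeg m' r
indeg-⊕ m m' r =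
  trans (sum-cong-≗ λ a → ex-⊕ m m' a r) (∑-distrib-+ (λ a → ex m a r) (λ a → ex m' a r))

degree-⊕ : ∀ (m m' : Mono d) → degree (m ⊕ m') ≡ degree m + degree m'
degree-⊕ m m' = trans (sum-cong-≗ (outdeg-⊕ m m')) (∑-distrib-+ (outdeg m) (outdeg m'))

ex≤degree : ∀ (m : Mono d) i j → ex m i j ≤ degree m
ex≤degree m i j = ℕₚ.≤-trans (term≤sum (ex m i) j) (term≤sum (outdeg m) i)

-- Equal net out-flow at every vertex, with both sides moved so that no subtraction occurs.
Balanced : Mono d → Mono d → Set
Balanced m m' = ∀ r → outdeg m r + indeg m' r ≡ outdeg m' r + indeg m r

δ : Fin d → Fin d → ℕ → ℤ
δ r i x = if does (r Fin.≟ i) then pos x else 0ℤ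

δ-≡ : ∀ (r : Fin d) x → δ r r x ≡ pos x
δ-≡ r x = cong (if_then pos x else 0ℤ) (dec-true (r Fin.≟ r) refl)

δ-≢ : ∀ {r i : Fin d} x → r ≢ i → δ r i x ≡ 0ℤ
δ-≢ {r = r} {i} x r≢i = cong (if_then pos x else 0ℤ) (dec-false (r Fin.≟ i) r≢i)

δ-0 : ∀ (r i : Fin d) → δ r i 0 ≡ 0ℤ
δ-0 r i with does (r Fin.≟ i)
... | true  = refl
... | false = refl

arcTerm+δ : ∀ (m : Mono d) → ValidMono m → ∀ r i j →
            arcTerm m r i j +ℤ δ r j (ex m i j) ≡ δ r i (ex m i j)
arcTerm+δ m vm r i j with i Fin.<? j
... | no i≮j = trans (cong₂ _+ℤ_ (arcTerm-≮ m r i≮j) (trans (cong (δ r j) (vm i j i≮j)) (δ-0 r j)))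
                     (sym (trans (cong (δ r i) (vm i j i≮j)) (δ-0 r i)))
... | yes i<j rewrite arcTerm-< m r i<j with r Fin.≟ i | r Fin.≟ j
...   | yes refl | yes r≡j = ⊥-elim (Finₚ.<⇒≢ i<j r≡j)
...   | yes refl | no _    = trans (ℤₚ.+-identityʳ _) (ℤₚ.*-identityˡ (pos (ex m i j)))
...   | no _     | yes refl =
  trans (cong (_+ℤ pos (ex m i j)) (ℤₚ.-1*i≡-i (pos (ex m i j)))) (ℤₚ.+-inverseˡ (pos (ex m i j)))
...   | no _     | no _    = refl

Amul+indeg : ∀ (m : Mono d) → ValidMono m → ∀ r → Amul m r +ℤ pos (indeg m r) ≡ pos (outdeg m r)
Amul+indeg m vm r = begin
  Amul m r +ℤ pos (indeg m r)
    ≡⟨ cong₂ _+ℤ_ (Amul≡sum m r) (sym (sum-pos (λ i → ex m i r))) ⟩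
  ∑ (λ i → ∑ (arcTerm m r i)) +ℤ ∑ (λ i → pos (ex m i r))
    ≡⟨ cong (∑ (λ i → ∑ (arcTerm m r i)) +ℤ_) (ℤ-sum.sum-cong-≗ in-column) ⟨
  ∑ (λ i → ∑ (arcTerm m r i)) +ℤ ∑ (λ i → ∑ λ j → δ r j (ex m i j))
    ≡⟨ ℤ-sum.∑-distrib-+ (λ i → ∑ (arcTerm m r i)) _ ⟨
  ∑ (λ i → ∑ (arcTerm m r i) +ℤ ∑ λ j → δ r j (ex m i j))
    ≡⟨ ℤ-sum.sum-cong-≗ (λ i → ℤ-sum.∑-distrib-+ (arcTerm m r i) _) ⟨
  ∑ (λ i → ∑ λ j → arcTerm m r i j +ℤ δ r j (ex m i j))
    ≡⟨ ℤ-sum.sum-cong-≗ (λ i → ℤ-sum.sum-cong-≗ (arcTerm+δ m vm r i)) ⟩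
  ∑ (λ i → ∑ λ j → δ r i (ex m i j))
    ≡⟨ ℤ-sum.sum-single _ r (λ i i≢r → ℤ-sum.sum-zero _ λ j → δ-≢ (ex m i j) (i≢r ∘ sym)) ⟩
  ∑ (λ j → δ r r (ex m r j))
    ≡⟨ ℤ-sum.sum-cong-≗ (λ j → δ-≡ r (ex m r j)) ⟩
  ∑ (λ j → pos (ex m r j))
    ≡⟨ sum-pos (ex m r) ⟩
  pos (outdeg m r) ∎
  where
  open ≡-Reasoning
  ∑ : ∀ {n} → (Fin n → ℤ) → ℤ
  ∑ = ℤ-sum.sum
  in-column : ∀ i → ∑ (λ j → δ r j (ex m i j)) ≡ pos (ex m i r)
  in-column i = trans (ℤ-sum.sum-single _ r λ j j≢r → δ-≢ (ex m i j) (j≢r ∘ sym)) (δ-≡ r (ex m i r))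

SameFibre⇒Balanced : ∀ (m m' : Mono d) → ValidMono m → ValidMono m' → SameFibre m m' → Balanced m m'
SameFibre⇒Balanced m m' vm vm' m∼m' r = ℤₚ.+-injective (begin
  pos (outdeg m r + indeg m' r)
    ≡⟨ ℤₚ.pos-+ (outdeg m r) (indeg m' r) ⟩
  pos (outdeg m r) +ℤ pos (indeg m' r)
    ≡⟨ cong (_+ℤ pos (indeg m' r)) (Amul+indeg m vm r) ⟨
  Amul m r +ℤ pos (indeg m r) +ℤ pos (indeg m' r)
    ≡⟨ xy∙z≈xz∙y (Amul m r) _ _ ⟩
  Amul m r +ℤ pos (indeg m' r) +ℤ pos (indeg m r)
    ≡⟨ cong (λ a → a +ℤ pos (indeg m' r) +ℤ pos (indeg m r)) (m∼m' r) ⟩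
  Amul m' r +ℤ pos (indeg m' r) +ℤ pos (indeg m r)
    ≡⟨ cong (_+ℤ pos (indeg m r)) (Amul+indeg m' vm' r) ⟩
  pos (outdeg m' r) +ℤ pos (indeg m r)
    ≡⟨ ℤₚ.pos-+ (outdeg m' r) (indeg m r) ⟨
  pos (outdeg m' r + indeg m r) ∎)
  where
  open ≡-Reasoning
  open CommSemigroupₚ ℤₚ.+-commutativeSemigroup using (xy∙z≈xz∙y)

Standard : Mono d → Set
Standard m = ∀ (x : Key _) → Increasing x → ¬ (lead x ∣M m)

path-∣M : ∀ (m : Mono d) {i j k} → i Fin.< j → 0 < ex m i j → 0 < ex m j k → path i j k ∣M m
path-∣M m {i} {j} {k} i<j = var⊕var-∣M m i j j k λ (i≡j , _) → Finₚ.<⇒≢ i<j i≡j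

nested-∣M : ∀ (m : Mono d) {i j k l} → i Fin.< j → 0 < ex m i l → 0 < ex m j k → nested i j k l ∣M m
nested-∣M m {i} {j} {k} {l} i<j = var⊕var-∣M m i l j k λ (i≡j , _) → Finₚ.<⇒≢ i<j i≡j

standard-∣M : ∀ (m' m : Mono d) → m' ∣M m → Standard m → Standard m'
standard-∣M m' m m'∣m sm x inc x∣m' = sm x inc (∣M-trans (lead x) m' m x∣m' m'∣m)

standard-∸M : ∀ (m m' : Mono d) → Standard m → Standard (m ∸M m')
standard-∸M m m' = standard-∣M (m ∸M m') m (∸M-∣M m m')

standard? : ∀ (m : Mono d) → Standard m ⊎ ∃ λ x → Increasing x × lead x ∣M m
standard? m with Finₚ.any? (λ i → Finₚ.any? λ j → Finₚ.any? λ k →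
                  (i Fin.<? j) ×-dec (j Fin.<? k) ×-dec (0 ℕ.<? ex m i j) ×-dec (0 ℕ.<? ex m j k))
               | Finₚ.any? (λ i → Finₚ.any? λ j → Finₚ.any? λ k → Finₚ.any? λ l →
                  (i Fin.<? j) ×-dec (j Fin.<? k) ×-dec (k Fin.<? l) ×-dec
                  (0 ℕ.<? ex m i l) ×-dec (0 ℕ.<? ex m j k))
... | yes (i , j , k , i<j , j<k , 0<eij , 0<ejk) | _ =
  inj₂ (inj₁ (i , j , k) , (i<j , j<k) , path-∣M m i<j 0<eij 0<ejk)
... | no _ | yes (i , j , k , l , i<j , j<k , k<l , 0<eil , 0<ejk) =
  inj₂ (inj₂ (i , j , k , l) , (i<j , j<k , k<l) , nested-∣M m i<j 0<eil 0<ejk)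
... | no no-path | no no-nested = inj₁ standard
  where
  standard : Standard m
  standard (inj₁ (i , j , k)) (i<j , j<k) p∣m =
    no-path (i , j , k , i<j , j<k , var⊕var-∣M⇒ {m = m} i j j k p∣m)
  standard (inj₂ (i , j , k , l)) (i<j , j<k , k<l) n∣m =
    no-nested (i , j , k , l , i<j , j<k , k<l , var⊕var-∣M⇒ {m = m} i l j k n∣m)

outdeg≡0⊎indeg≡0 : ∀ (m : Mono d) → ValidMono m → Standard m → ∀ r →
                   outdeg m r ≡ 0 ⊎ indeg m r ≡ 0
outdeg≡0⊎indeg≡0 m vm sm r with outdeg m r ℕ.≟ 0
... | yes out≡0 = inj₁ out≡0
... | no out≢0 with positive-term (ex m r) (ℕₚ.n≢0⇒n>0 out≢0)
...   | c , 0<erc = inj₂ (sum-zero _ no-arc-into-r)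
  where
  no-arc-into-r : ∀ a → ex m a r ≡ 0
  no-arc-into-r a with ex m a r ℕ.≟ 0
  ... | yes ear≡0 = ear≡0
  ... | no ear≢0  =
    ⊥-elim (sm (inj₁ (a , r , c)) (a<r , valid-pos m vm r c 0<erc) (path-∣M m a<r 0<ear 0<erc))
    where
    0<ear = ℕₚ.n≢0⇒n>0 ear≢0
    a<r = valid-pos m vm a r 0<ear

balance-cancel : ∀ {a b a' b' : ℕ} → a + b' ≡ a' + b → a ≡ 0 ⊎ b ≡ 0 → a' ≡ 0 ⊎ b' ≡ 0 →
                 a ≡ a' × b ≡ b'
balance-cancel                   e (inj₁ refl) (inj₁ refl) = refl , sym e
balance-cancel {a' = a'}         e (inj₁ refl) (inj₂ refl) =
  sym (ℕₚ.m+n≡0⇒m≡0 a' (sym e)) , ℕₚ.m+n≡0⇒n≡0 a' (sym e)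
balance-cancel {a = a}           e (inj₂ refl) (inj₁ refl) = ℕₚ.m+n≡0⇒m≡0 a e , sym (ℕₚ.m+n≡0⇒n≡0 a e)
balance-cancel {a = a} {a' = a'} e (inj₂ refl) (inj₂ refl) = ℕₚ.+-cancelʳ-≡ 0 a a' e , refl

SameDegrees : Mono d → Mono d → Set
SameDegrees m m' = (∀ r → outdeg m r ≡ outdeg m' r) × (∀ r → indeg m r ≡ indeg m' r)

Balanced⇒SameDegrees : ∀ (m m' : Mono d) → ValidMono m → ValidMono m' → Standard m → Standard m' →
                       Balanced m m' → SameDegrees m m'
Balanced⇒SameDegrees m m' vm vm' sm sm' bal = proj₁ ∘ cancel , proj₂ ∘ cancel
  where
  cancel : ∀ r → outdeg m r ≡ outdeg m' r × indeg m r ≡ indeg m' r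
  cancel r = balance-cancel (bal r) (outdeg≡0⊎indeg≡0 m vm sm r) (outdeg≡0⊎indeg≡0 m' vm' sm' r)

SameDegrees-cancelʳ : ∀ (m m' X : Mono d) → SameDegrees (m ⊕ X) (m' ⊕ X) → SameDegrees m m'
SameDegrees-cancelʳ m m' X (same-out , same-in) =
  (λ r → ℕₚ.+-cancelʳ-≡ (outdeg X r) _ _
           (trans (sym (outdeg-⊕ m X r)) (trans (same-out r) (outdeg-⊕ m' X r)))) ,
  (λ r → ℕₚ.+-cancelʳ-≡ (indeg X r) _ _
           (trans (sym (indeg-⊕ m X r)) (trans (same-in r) (indeg-⊕ m' X r))))

first-nonzero : ∀ {n} (f : Fin n → ℕ) {x} → 0 < f x →
                ∃ λ i → 0 < f i × (∀ r → r Fin.< i → f r ≡ 0)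
first-nonzero f {x} 0<fx
  with Finₚ.¬∀⟶∃¬-smallest _ (λ r → f r ≡ 0) (λ r → f r ℕ.≟ 0)
                            (λ all≡0 → ℕₚ.<⇒≢ 0<fx (sym (all≡0 x)))
... | i , fi≢0 , below = i , ℕₚ.n≢0⇒n>0 fi≢0 , λ r r<i →
  subst (λ s → f s ≡ 0) (Finₚ.toℕ-injective (trans (Finₚ.toℕ-inject _) (Finₚ.toℕ-fromℕ< r<i)))
        (below (Fin.fromℕ< r<i))

-- Otherwise an arc i → c with c > t and an arc s → t with s > i would be nested: i < s < t < c.
first-arc : ∀ (m : Mono d) → ValidMono m → Standard m → ∀ {i t} →
            0 < outdeg m i → (∀ r → r Fin.< i → outdeg m r ≡ 0) →
            0 < indeg m t → (∀ r → r Fin.< t → indeg m r ≡ 0) → 0 < ex m i t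
first-arc m vm sm {i} {t} 0<out first-tail 0<in first-head
  with positive-term (ex m i) 0<out | positive-term (λ a → ex m a t) 0<in
... | c , 0<eic | s , 0<est with Finₚ.<-cmp c t | Finₚ.<-cmp s i
... | tri< c<t _ _ | _ =
  ⊥-elim (ℕₚ.<⇒≢ (ℕₚ.<-≤-trans 0<eic (term≤sum (λ a → ex m a c) i)) (sym (first-head c c<t)))
... | tri≈ _ refl _ | _ = 0<eic
... | tri> _ _ _ | tri< s<i _ _ =
  ⊥-elim (ℕₚ.<⇒≢ (ℕₚ.<-≤-trans 0<est (term≤sum (ex m s) t)) (sym (first-tail s s<i)))
... | tri> _ _ _ | tri≈ _ refl _ = 0<est
... | tri> _ _ t<c | tri> _ _ i<s =
  ⊥-elim (sm (inj₂ (i , s , t , c)) (i<s , valid-pos m vm s t 0<est , t<c) (nested-∣M m i<s 0<eic 0<est))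

common-arc : ∀ (m m' : Mono d) → ValidMono m → ValidMono m' → Standard m → Standard m' →
             SameDegrees m m' → 0 < degree m → ∃ λ i → ∃ λ t → 0 < ex m i t × 0 < ex m' i t
common-arc m m' vm vm' sm sm' (same-out , same-in) 0<deg
  with positive-term (outdeg m) 0<deg
... | _ , 0<out-x with first-nonzero (outdeg m) 0<out-x
... | i , 0<out-i , first-tail with positive-term (ex m i) 0<out-i
... | c , 0<eic with first-nonzero (indeg m) (ℕₚ.<-≤-trans 0<eic (term≤sum (λ a → ex m a c) i))
... | t , 0<in-t , first-head =
  i , t , first-arc m vm sm 0<out-i first-tail 0<in-t first-head ,
  first-arc m' vm' sm' (subst (0 <_) (same-out i) 0<out-i) (λ r r<i → trans (sym (same-out r)) (first-tail r r<i))
                       (subst (0 <_) (same-in t) 0<in-t) (λ r r<t → trans (sym (same-in r)) (first-head r r<t))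

degree-∸M< : ∀ {m X : Mono d} → X ∣M m → 0 < degree X → degree (m ∸M X) < degree m
degree-∸M< {m = m} {X} X∣m 0<degX = begin-strict
  degree (m ∸M X)              ≡⟨ ℕₚ.+-identityʳ _ ⟨
  degree (m ∸M X) + 0          <⟨ ℕₚ.+-monoʳ-< (degree (m ∸M X)) 0<degX ⟩
  degree (m ∸M X) + degree X   ≡⟨ degree-⊕ (m ∸M X) X ⟨
  degree ((m ∸M X) ⊕ X)        ≡⟨ cong degree (∣M⇒≡∸M⊕ m X X∣m) ⟨
  degree m                     ∎
  where open ℕₚ.≤-Reasoning

0<degree-var : ∀ (i j : Fin d) → 0 < degree (var i j)
0<degree-var i j = ℕₚ.<-≤-trans (0<ex-var i j) (ex≤degree (var i j) i j)

degree≡0⇒ex≡0 : ∀ (m : Mono d) → degree m ≡ 0 → ∀ i j → ex m i j ≡ 0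
degree≡0⇒ex≡0 m deg≡0 i j = ℕₚ.n≤0⇒n≡0 (subst (ex m i j ≤_) deg≡0 (ex≤degree m i j))

standard-unique : ∀ n (m m' : Mono d) → degree m < n → ValidMono m → ValidMono m' →
                  Standard m → Standard m' → SameDegrees m m' → m ≡ m'
standard-unique (suc n) m m' deg<n vm vm' sm sm' same with degree m ℕ.≟ 0
... | yes deg≡0 =
  mono-ext λ i j → trans (degree≡0⇒ex≡0 m deg≡0 i j) (sym (degree≡0⇒ex≡0 m' deg'≡0 i j))
  where
  deg'≡0 : degree m' ≡ 0
  deg'≡0 = trans (sum-cong-≗ (sym ∘ proj₁ same)) deg≡0
... | no deg≢0 with common-arc m m' vm vm' sm sm' same (ℕₚ.n≢0⇒n>0 deg≢0)
...   | i , t , 0<eit , 0<e'it = begin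
  m               ≡⟨ ∣M⇒≡∸M⊕ m X X∣m ⟩
  (m ∸M X) ⊕ X    ≡⟨ cong (_⊕ X) (standard-unique n (m ∸M X) (m' ∸M X) deg₀<n
                                   (valid-∸M m X vm) (valid-∸M m' X vm')
                                   (standard-∸M m X sm) (standard-∸M m' X sm') same₀) ⟩
  (m' ∸M X) ⊕ X   ≡⟨ ∣M⇒≡∸M⊕ m' X X∣m' ⟨
  m'              ∎
  where
  open ≡-Reasoning
  X = var i t
  X∣m = var-∣M m i t 0<eit
  X∣m' = var-∣M m' i t 0<e'it
  deg₀<n = ℕₚ.<-≤-trans (degree-∸M< {m = m} {X} X∣m (0<degree-var i t)) (ℕₚ.≤-pred deg<n)
  same₀ = SameDegrees-cancelʳ (m ∸M X) (m' ∸M X) X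
            (subst₂ SameDegrees (∣M⇒≡∸M⊕ m X X∣m) (∣M⇒≡∸M⊕ m' X X∣m') same)

-- The summand d² makes x_{ik} lighter than x_{ij}x_{jk}, as 2(j−i)(k−j) < d²; convexity
-- of the square makes x_{ik}x_{jl} lighter than x_{il}x_{jk}.
arcWeight : Fin d → Fin d → ℕ
arcWeight {d} i j = d * d + span i j * span i j

weight : Mono d → ℕ
weight m = sum λ i → sum λ j → ex m i j * arcWeight i j

weight-⊕ : ∀ (m m' : Mono d) → weight (m ⊕ m') ≡ weight m + weight m'
weight-⊕ {d} m m' = begin
  sum (λ i → sum λ j → ex (m ⊕ m') i j * arcWeight i j)
    ≡⟨ sum-cong-≗ (λ i → sum-cong-≗ (term-⊕ i)) ⟩
  sum (λ i → sum λ j → term m i j + term m' i j)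
    ≡⟨ sum-cong-≗ (λ i → ∑-distrib-+ (term m i) (term m' i)) ⟩
  sum (λ i → sum (term m i) + sum (term m' i))
    ≡⟨ ∑-distrib-+ (λ i → sum (term m i)) (λ i → sum (term m' i)) ⟩
  weight m + weight m' ∎
  where
  open ≡-Reasoning
  term : Mono d → Fin d → Fin d → ℕ
  term m i j = ex m i j * arcWeight i j
  term-⊕ : ∀ i j → ex (m ⊕ m') i j * arcWeight i j ≡ term m i j + term m' i j
  term-⊕ i j = trans (cong (_* arcWeight i j) (ex-⊕ m m' i j)) (ℕₚ.*-distribʳ-+ (arcWeight i j) (ex m i j) (ex m' i j))

weight-var : ∀ (i j : Fin d) → weight (var i j) ≡ arcWeight i j
weight-var i j = begin
  sum (λ a → sum λ b → ex (var i j) a b * arcWeight a b)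
    ≡⟨ sum-single _ i (λ a a≢i → sum-zero _ λ b →
                         cong (_* arcWeight a b) (ex-var-≢ i j a b (a≢i ∘ proj₁))) ⟩
  sum (λ b → ex (var i j) i b * arcWeight i b)
    ≡⟨ sum-single _ j (λ b b≢j → cong (_* arcWeight i b) (ex-var-≢ i j i b (b≢j ∘ proj₂))) ⟩
  ex (var i j) i j * arcWeight i j
    ≡⟨ cong (_* arcWeight i j) (ex-var-≡ i j) ⟩
  1 * arcWeight i j
    ≡⟨ ℕₚ.*-identityˡ (arcWeight i j) ⟩
  arcWeight i j ∎
  where open ≡-Reasoning

weight-var⊕var : ∀ (i j k l : Fin d) → weight (var i j ⊕ var k l) ≡ arcWeight i j + arcWeight k l
weight-var⊕var i j k l = trans (weight-⊕ (var i j) (var k l)) (cong₂ _+_ (weight-var i j) (weight-var k l))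

square-split-drop : ∀ E x y → 2 * x * y < E → E + (x + y) * (x + y) < (E + x * x) + (E + y * y)
square-split-drop E x y 2xy<E =
  subst₂ _<_ (sym (expand₁ E x y)) (sym (expand₂ E x y)) (ℕₚ.+-monoʳ-< (E + x * x + y * y) 2xy<E)
  where
  expand₁ : ∀ E x y → E + (x + y) * (x + y) ≡ (E + x * x + y * y) + 2 * x * y
  expand₁ = solve 3 (λ E x y → E :+ (x :+ y) :* (x :+ y) := (E :+ x :* x :+ y :* y) :+ con 2 :* x :* y) refl
  expand₂ : ∀ E x y → (E + x * x) + (E + y * y) ≡ (E + x * x + y * y) + E
  expand₂ = solve 3 (λ E x y → (E :+ x :* x) :+ (E :+ y :* y) := (E :+ x :* x :+ y :* y) :+ E) refl

2xy<n² : ∀ {n} x y → x + y < n → 2 * x * y < n * n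
2xy<n² x y x+y<n =
  ℕₚ.≤-<-trans (subst (2 * x * y ≤_) (sym (expand x y)) (ℕₚ.m≤m+n _ _)) (ℕₚ.*-mono-< x+y<n x+y<n)
  where
  expand : ∀ x y → (x + y) * (x + y) ≡ 2 * x * y + (x * x + y * y)
  expand = solve 2 (λ x y → (x :+ y) :* (x :+ y) := con 2 :* x :* y :+ (x :* x :+ y :* y)) refl

square-cross-drop : ∀ E p q s → 0 < p → 0 < s →
  (E + (p + q) * (p + q)) + (E + (q + s) * (q + s)) < (E + (p + q + s) * (p + q + s)) + (E + q * q)
square-cross-drop E p q s 0<p 0<s =
  subst ((E + (p + q) * (p + q)) + (E + (q + s) * (q + s)) <_) (sym (expand E p q s))
        (ℕₚ.m<m+n _ (ℕₚ.*-mono-< (ℕₚ.*-monoʳ-< 2 0<p) 0<s))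
  where
  expand : ∀ E p q s → (E + (p + q + s) * (p + q + s)) + (E + q * q)
                     ≡ ((E + (p + q) * (p + q)) + (E + (q + s) * (q + s))) + 2 * p * s
  expand = solve 4 (λ E p q s → (E :+ (p :+ q :+ s) :* (p :+ q :+ s)) :+ (E :+ q :* q)
                   := ((E :+ (p :+ q) :* (p :+ q)) :+ (E :+ (q :+ s) :* (q :+ s))) :+ con 2 :* p :* s) refl

weight-trail<lead : ∀ (x : Key d) → Increasing x → weight (trail x) < weight (lead x)
weight-trail<lead {d} (inj₁ (i , j , k)) (i<j , j<k) = begin-strict
  weight (var i k)                      ≡⟨ weight-var i k ⟩
  d * d + span i k * span i k           ≡⟨ cong (λ s → d * d + s * s) span-ik ⟩
  d * d + (p + q) * (p + q)             <⟨ square-split-drop (d * d) p q (2xy<n² p q p+q<d) ⟩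
  (d * d + p * p) + (d * d + q * q)     ≡⟨ weight-var⊕var i j j k ⟨
  weight (path i j k)                   ∎
  where
  open ℕₚ.≤-Reasoning
  p = span i j
  q = span j k
  span-ik = span-+ (ℕₚ.<⇒≤ i<j) (ℕₚ.<⇒≤ j<k)
  p+q<d = subst (_< d) span-ik (ℕₚ.≤-<-trans (ℕₚ.m∸n≤m (toℕ k) (toℕ i)) (Finₚ.toℕ<n k))
weight-trail<lead {d} (inj₂ (i , j , k , l)) (i<j , j<k , k<l) = begin-strict
  weight (crossing i j k l)
    ≡⟨ weight-var⊕var i k j l ⟩
  arcWeight i k + arcWeight j l
    ≡⟨ cong₂ (λ u v → (d * d + u * u) + (d * d + v * v)) span-ik span-jl ⟩
  (d * d + (p + q) * (p + q)) + (d * d + (q + s) * (q + s))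
    <⟨ square-cross-drop (d * d) p q s (ℕₚ.m<n⇒0<n∸m i<j) (ℕₚ.m<n⇒0<n∸m k<l) ⟩
  (d * d + (p + q + s) * (p + q + s)) + (d * d + q * q)
    ≡⟨ cong (λ u → (d * d + u * u) + arcWeight j k) span-il ⟨
  arcWeight i l + arcWeight j k
    ≡⟨ weight-var⊕var i l j k ⟨
  weight (nested i j k l) ∎
  where
  open ℕₚ.≤-Reasoning
  p = span i j
  q = span j k
  s = span k l
  span-ik = span-+ (ℕₚ.<⇒≤ i<j) (ℕₚ.<⇒≤ j<k)
  span-jl = span-+ (ℕₚ.<⇒≤ j<k) (ℕₚ.<⇒≤ k<l)
  span-il = trans (span-+ (ℕₚ.<⇒≤ (Finₚ.<-trans i<j j<k)) (ℕₚ.<⇒≤ k<l)) (cong (_+ s) span-ik)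

valid-lead : ∀ (x : Key d) → Increasing x → ValidMono (lead x)
valid-lead (inj₁ (i , j , k)) (i<j , j<k)       = valid-⊕ (var i j) (var j k) (valid-var i<j) (valid-var j<k)
valid-lead (inj₂ (i , j , k , l)) (i<j , j<k , k<l) =
  valid-⊕ (var i l) (var j k) (valid-var (Finₚ.<-trans i<j (Finₚ.<-trans j<k k<l))) (valid-var j<k)

valid-trail : ∀ (x : Key d) → Increasing x → ValidMono (trail x)
valid-trail (inj₁ _) (i<j , j<k)       = valid-var (Finₚ.<-trans i<j j<k)
valid-trail (inj₂ (i , j , k , l)) (i<j , j<k , k<l) =
  valid-⊕ (var i k) (var j l) (valid-var (Finₚ.<-trans i<j j<k)) (valid-var (Finₚ.<-trans j<k k<l))

_⪰_ : Mono d → Mono d → Set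
m ⪰ m' = m ≡ m' ⊎ m ≻ m'

StandardBelow : Mono d → Set
StandardBelow m = ∃ λ s → ValidMono s × Standard s × SameFibre s m × m ⪰ s

rewrite-lead : Key d → Mono d → Mono d
rewrite-lead x m = (m ∸M lead x) ⊕ trail x

≻-rewrite-lead : ∀ (x : Key d) m → Increasing x → lead x ∣M m → m ≻ rewrite-lead x m
≻-rewrite-lead x m inc x∣m =
  subst (_≻ rewrite-lead x m) (sym (∣M⇒≡∸M⊕ m (lead x) x∣m))
        (⊕-monoʳ-≻ (m ∸M lead x) (lead≻trail x inc))

rewrite-lead-∼ : ∀ (x : Key d) m → Increasing x → lead x ∣M m → SameFibre (rewrite-lead x m) m
rewrite-lead-∼ x m inc x∣m =
  subst (SameFibre (rewrite-lead x m)) (sym (∣M⇒≡∸M⊕ m (lead x) x∣m))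
        (SameFibre-⊕ˡ (m ∸M lead x) (sym ∘ lead∼trail x inc))

weight-rewrite-lead< : ∀ (x : Key d) m → Increasing x → lead x ∣M m → weight (rewrite-lead x m) < weight m
weight-rewrite-lead< x m inc x∣m = begin-strict
  weight (rewrite-lead x m)                   ≡⟨ weight-⊕ (m ∸M lead x) (trail x) ⟩
  weight (m ∸M lead x) + weight (trail x)     <⟨ ℕₚ.+-monoʳ-< (weight (m ∸M lead x)) (weight-trail<lead x inc) ⟩
  weight (m ∸M lead x) + weight (lead x)      ≡⟨ weight-⊕ (m ∸M lead x) (lead x) ⟨
  weight ((m ∸M lead x) ⊕ lead x)             ≡⟨ cong weight (∣M⇒≡∸M⊕ m (lead x) x∣m) ⟨
  weight m                                    ∎
  where open ℕₚ.≤-Reasoning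

valid-rewrite-lead : ∀ (x : Key d) m → Increasing x → ValidMono m → ValidMono (rewrite-lead x m)
valid-rewrite-lead x m inc vm = valid-⊕ (m ∸M lead x) (trail x) (valid-∸M m (lead x) vm) (valid-trail x inc)

reduce-to-standard : ∀ n (m : Mono d) → weight m < n → ValidMono m → StandardBelow m
reduce-to-standard (suc n) m w<n vm with standard? m
... | inj₁ sm = m , vm , sm , (λ _ → refl) , inj₁ refl
... | inj₂ (x , inc , x∣m) = extend (reduce-to-standard n m₁ w₁<n (valid-rewrite-lead x m inc vm))
  where
  m₁ = rewrite-lead x m
  w₁<n = ℕₚ.<-≤-trans (weight-rewrite-lead< x m inc x∣m) (ℕₚ.≤-pred w<n)
  m≻m₁ = ≻-rewrite-lead x m inc x∣m
  extend : StandardBelow m₁ → StandardBelow m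
  extend (s , vs , ss , s∼m₁ , m₁⪰s) =
    s , vs , ss , SameFibre-trans {m₁ = s} {m₁} {m} s∼m₁ (rewrite-lead-∼ x m inc x∣m) ,
    inj₂ (m≻s m₁⪰s)
    where
    m≻s : m₁ ⪰ s → m ≻ s
    m≻s (inj₁ refl)  = m≻m₁
    m≻s (inj₂ m₁≻s) = ≻-trans {m₁ = m} {m₁} {s} m≻m₁ m₁≻s

standard-least : ∀ (m m' : Mono d) → ValidMono m → Standard m → ValidMono m' →
                 SameFibre m' m → m' ≢ m → m' ≻ m
standard-least m m' vm sm vm' m'∼m m'≢m with reduce-to-standard (suc (weight m')) m' (ℕₚ.n<1+n _) vm'
... | s , vs , ss , s∼m' , m'⪰s with standard-unique (suc (degree s)) s m (ℕₚ.n<1+n _) vs vm ss sm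
                                      (Balanced⇒SameDegrees s m vs vm ss sm
                                        (SameFibre⇒Balanced s m vs vm (SameFibre-trans {m₁ = s} {m'} {m} s∼m' m'∼m)))
... | refl with m'⪰s
...   | inj₁ m'≡m  = ⊥-elim (m'≢m m'≡m)
...   | inj₂ m'≻m = m'≻m

lead∣lead⇒≡ : ∀ (x y : Key d) → Increasing x → Increasing y → lead y ∣M lead x → x ≡ y
lead∣lead⇒≡ (inj₁ (i , j , k)) (inj₁ (a , b , c)) (i<j , j<k) _ y∣x
  with var⊕var-∣M⇒ {m = path i j k} a b b c y∣x
... | 0<ab , 0<bc with ex-var⊕var-pos i j j k a b 0<ab | ex-var⊕var-pos i j j k b c 0<bc
... | inj₁ (refl , refl) | inj₂ (refl , refl) = refl
... | inj₁ (_ , refl)    | inj₁ (b≡i , _)     = ⊥-elim (Finₚ.<⇒≢ i<j (sym b≡i))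
... | inj₂ (_ , refl)    | inj₁ (b≡i , _)     = ⊥-elim (Finₚ.<⇒≢ (Finₚ.<-trans i<j j<k) (sym b≡i))
... | inj₂ (_ , refl)    | inj₂ (b≡j , _)     = ⊥-elim (Finₚ.<⇒≢ j<k (sym b≡j))
lead∣lead⇒≡ (inj₂ (i , j , k , l)) (inj₁ (a , b , c)) (i<j , j<k , k<l) _ y∣x
  with var⊕var-∣M⇒ {m = nested i j k l} a b b c y∣x
... | 0<ab , 0<bc with ex-var⊕var-pos i l j k a b 0<ab | ex-var⊕var-pos i l j k b c 0<bc
... | inj₁ (_ , refl) | inj₁ (b≡i , _) = ⊥-elim (Finₚ.<⇒≢ (Finₚ.<-trans i<j (Finₚ.<-trans j<k k<l)) (sym b≡i))
... | inj₁ (_ , refl) | inj₂ (b≡j , _) = ⊥-elim (Finₚ.<⇒≢ (Finₚ.<-trans j<k k<l) (sym b≡j))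
... | inj₂ (_ , refl) | inj₁ (b≡i , _) = ⊥-elim (Finₚ.<⇒≢ (Finₚ.<-trans i<j j<k) (sym b≡i))
... | inj₂ (_ , refl) | inj₂ (b≡j , _) = ⊥-elim (Finₚ.<⇒≢ j<k (sym b≡j))
lead∣lead⇒≡ (inj₁ (i , j , k)) (inj₂ (a , b , c , e)) (i<j , j<k) (a<b , b<c , c<e) y∣x
  with var⊕var-∣M⇒ {m = path i j k} a e b c y∣x
... | 0<ae , 0<bc with ex-var⊕var-pos i j j k a e 0<ae | ex-var⊕var-pos i j j k b c 0<bc
... | inj₁ (refl , _)    | inj₁ (refl , _)    = ⊥-elim (Finₚ.<-irrefl refl a<b)
... | inj₁ (_ , refl)    | inj₂ (refl , refl) = ⊥-elim (Finₚ.<-irrefl refl (Finₚ.<-trans b<c c<e))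
... | inj₂ (refl , _)    | inj₁ (refl , _)    = ⊥-elim (Finₚ.<-asym a<b i<j)
... | inj₂ (refl , _)    | inj₂ (refl , _)    = ⊥-elim (Finₚ.<-irrefl refl a<b)
lead∣lead⇒≡ (inj₂ (i , j , k , l)) (inj₂ (a , b , c , e)) (i<j , j<k , k<l) (a<b , b<c , c<e) y∣x
  with var⊕var-∣M⇒ {m = nested i j k l} a e b c y∣x
... | 0<ae , 0<bc with ex-var⊕var-pos i l j k a e 0<ae | ex-var⊕var-pos i l j k b c 0<bc
... | inj₁ (refl , refl) | inj₂ (refl , refl) = refl
... | inj₁ (refl , _)    | inj₁ (refl , _)    = ⊥-elim (Finₚ.<-irrefl refl a<b)
... | inj₂ (refl , _)    | inj₁ (refl , _)    = ⊥-elim (Finₚ.<-asym a<b i<j)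
... | inj₂ (refl , _)    | inj₂ (refl , _)    = ⊥-elim (Finₚ.<-irrefl refl a<b)

trail-standard : ∀ (x : Key d) → Increasing x → Standard (trail x)
trail-standard (inj₁ (i , j , k)) (i<j , j<k) (inj₁ (a , b , c)) _ y∣x
  with var⊕var-∣M⇒ {m = var i k} a b b c y∣x
... | 0<ab , 0<bc with ex-var-pos i k a b 0<ab | ex-var-pos i k b c 0<bc
... | _ , refl | refl , _ = Finₚ.<-irrefl refl (Finₚ.<-trans i<j j<k)
trail-standard (inj₁ (i , j , k)) (i<j , j<k) (inj₂ (a , b , c , e)) (a<b , _) y∣x
  with var⊕var-∣M⇒ {m = var i k} a e b c y∣x
... | 0<ae , 0<bc with ex-var-pos i k a e 0<ae | ex-var-pos i k b c 0<bc
... | refl , _ | refl , _ = Finₚ.<-irrefl refl a<b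
trail-standard (inj₂ (i , j , k , l)) (i<j , j<k , k<l) (inj₁ (a , b , c)) _ y∣x
  with var⊕var-∣M⇒ {m = crossing i j k l} a b b c y∣x
... | 0<ab , 0<bc with ex-var⊕var-pos i k j l a b 0<ab | ex-var⊕var-pos i k j l b c 0<bc
... | inj₁ (_ , refl) | inj₁ (b≡i , _) = Finₚ.<⇒≢ (Finₚ.<-trans i<j j<k) (sym b≡i)
... | inj₁ (_ , refl) | inj₂ (b≡j , _) = Finₚ.<⇒≢ j<k (sym b≡j)
... | inj₂ (_ , refl) | inj₁ (b≡i , _) = Finₚ.<⇒≢ (Finₚ.<-trans i<j (Finₚ.<-trans j<k k<l)) (sym b≡i)
... | inj₂ (_ , refl) | inj₂ (b≡j , _) = Finₚ.<⇒≢ (Finₚ.<-trans j<k k<l) (sym b≡j)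
trail-standard (inj₂ (i , j , k , l)) (i<j , j<k , k<l) (inj₂ (a , b , c , e)) (a<b , b<c , c<e) y∣x
  with var⊕var-∣M⇒ {m = crossing i j k l} a e b c y∣x
... | 0<ae , 0<bc with ex-var⊕var-pos i k j l a e 0<ae | ex-var⊕var-pos i k j l b c 0<bc
... | inj₁ (refl , _)    | inj₁ (refl , _)    = Finₚ.<-irrefl refl a<b
... | inj₁ (_ , refl)    | inj₂ (_ , refl)    = Finₚ.<-asym c<e k<l
... | inj₂ (refl , _)    | inj₁ (refl , _)    = Finₚ.<-asym a<b i<j
... | inj₂ (refl , _)    | inj₂ (refl , _)    = Finₚ.<-irrefl refl a<b

lookup-map : ∀ {a b} {A : Set a} {B : Set b} (f : A → B) (xs : List A) i →
             lookup (List.map f xs) i ≡ f (lookup xs (Fin.cast (Listₚ.length-map f xs) i))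
lookup-map f (x ∷ xs) zero    = refl
lookup-map f (x ∷ xs) (suc i) = lookup-map f xs i

cast-injective : ∀ {m n} .(eq : m ≡ n) {i j : Fin m} → Fin.cast eq i ≡ Fin.cast eq j → i ≡ j
cast-injective eq {i} {j} ci≡cj =
  Finₚ.toℕ-injective (trans (sym (Finₚ.toℕ-cast eq i)) (trans (cong toℕ ci≡cj) (Finₚ.toℕ-cast eq j)))

Unique⇒lookup-injective : ∀ {a} {A : Set a} {xs : List A} → Unique xs →
                          ∀ i j → lookup xs i ≡ lookup xs j → i ≡ j
Unique⇒lookup-injective               (_ ∷ _)    zero    zero    _  = refl
Unique⇒lookup-injective {xs = _ ∷ xs} (x∉xs ∷ _) zero    (suc j) eq =
  ⊥-elim (All.lookup x∉xs (∈-lookup {xs = xs} j) eq)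
Unique⇒lookup-injective {xs = _ ∷ xs} (x∉xs ∷ _) (suc i) zero    eq =
  ⊥-elim (All.lookup x∉xs (∈-lookup {xs = xs} i) (sym eq))
Unique⇒lookup-injective               (_ ∷ u)    (suc i) (suc j) eq = cong suc (Unique⇒lookup-injective u i j eq)

Unique-concatMap : ∀ {a b} {A : Set a} {B : Set b} (f : A → List B) (g : B → A) {xs : List A} →
                   Unique xs → (∀ x → Unique (f x)) → (∀ {x y} → y ∈ f x → g y ≡ x) →
                   Unique (List.concatMap f xs)
Unique-concatMap f g uxs uf g-inverts =
  Uniqueₚ.concat⁺ (Allₚ.map⁺ (All.universal uf _)) (AllPairsₚ.map⁺ (AllPairs.map disjoint uxs))
  where
  disjoint : ∀ {x x'} → x ≢ x' → Disjoint (f x) (f x')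
  disjoint x≢x' (y∈fx , y∈fx') = x≢x' (trans (sym (g-inverts y∈fx)) (g-inverts y∈fx'))

listSum : ∀ {a} {A : Set a} → (A → ℕ) → List A → ℕ
listSum f []       = 0
listSum f (x ∷ xs) = f x + listSum f xs

module _ {a} {A : Set a} where

  length≡listSum : ∀ (xs : List A) → length xs ≡ listSum (λ _ → 1) xs
  length≡listSum []       = refl
  length≡listSum (x ∷ xs) = cong suc (length≡listSum xs)

  listSum-cong : ∀ (xs : List A) {f g : A → ℕ} → (∀ x → f x ≡ g x) → listSum f xs ≡ listSum g xs
  listSum-cong []       f≗g = refl
  listSum-cong (x ∷ xs) f≗g = cong₂ _+_ (f≗g x) (listSum-cong xs f≗g)

  listSum-++ : ∀ (xs ys : List A) f → listSum f (xs ++ ys) ≡ listSum f xs + listSum f ys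
  listSum-++ []       ys f = refl
  listSum-++ (x ∷ xs) ys f = trans (cong (f x +_) (listSum-++ xs ys f)) (sym (ℕₚ.+-assoc (f x) _ _))

  listSum-filter : ∀ {p} {P : A → Set p} (P? : ∀ x → Dec (P x)) (xs : List A) f →
                   listSum f (List.filter P? xs) ≡ listSum (λ x → if does (P? x) then f x else 0) xs
  listSum-filter P? []       f = refl
  listSum-filter P? (x ∷ xs) f with does (P? x)
  ... | true  = cong (f x +_) (listSum-filter P? xs f)
  ... | false = listSum-filter P? xs f

listSum-map : ∀ {a b} {A : Set a} {B : Set b} (h : A → B) (xs : List A) f →
              listSum f (List.map h xs) ≡ listSum (f ∘ h) xs
listSum-map h []       f = refl
listSum-map h (x ∷ xs) f = cong (f (h x) +_) (listSum-map h xs f)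

listSum-concatMap : ∀ {a b} {A : Set a} {B : Set b} (h : A → List B) (xs : List A) f →
                    listSum f (List.concatMap h xs) ≡ listSum (listSum f ∘ h) xs
listSum-concatMap h []       f = refl
listSum-concatMap h (x ∷ xs) f =
  trans (listSum-++ (h x) (List.concatMap h xs) f) (cong (listSum f (h x) +_) (listSum-concatMap h xs f))

listSum-tabulate : ∀ {a} {A : Set a} {n} (g : Fin n → A) f → listSum f (List.tabulate g) ≡ sum (f ∘ g)
listSum-tabulate {n = zero}  g f = refl
listSum-tabulate {n = suc n} g f = cong (f (g zero) +_) (listSum-tabulate (g ∘ suc) f)

listSum-allFin : ∀ {n} (f : Fin n → ℕ) → listSum f (List.allFin n) ≡ sum f
listSum-allFin = listSum-tabulate Function.id

-- chains r i counts the chains i < k₁ < ⋯ < k_r in Fin n.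
chains : ∀ {n} → ℕ → Fin n → ℕ
chains         zero    i = 1
chains {n} (suc r) i = sum {n} λ k → if does (i Fin.<? k) then chains r k else 0

chains-suc : ∀ {n} r (i : Fin n) → chains r (suc i) ≡ chains r i
chains-suc zero    i = refl
chains-suc {n} (suc r) i = sum-cong-≗ {n} λ k → cong (if does (i Fin.<? k) then_else 0) (chains-suc r k)

sum-chains : ∀ n r → sum (chains {n} r) ≡ n C suc r
sum-chains zero    r       = refl
sum-chains (suc n) zero    = trans (cong suc (sum-ones n)) (sym (nC1≡n (suc n)))
  where
  sum-ones : ∀ n → sum {n} (λ _ → 1) ≡ n
  sum-ones zero    = refl
  sum-ones (suc n) = cong suc (sum-ones n)
sum-chains (suc n) (suc r) = begin
  chains {suc n} (suc r) zero + sum {n} (chains (suc r) ∘ suc)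
    ≡⟨ cong₂ _+_ (sum-cong-≗ (chains-suc {n} r)) (sum-cong-≗ (chains-suc {n} (suc r))) ⟩
  sum (chains {n} r) + sum (chains {n} (suc r))
    ≡⟨ cong₂ _+_ (sum-chains n r) (sum-chains n (suc r)) ⟩
  n C suc r + n C suc (suc r)
    ≡⟨ nCk+nC[k+1]≡[n+1]C[k+1] n (suc r) ⟩
  suc n C suc (suc r) ∎
  where open ≡-Reasoning

sum-if-const : ∀ {n} (b : Fin n → Bool) (c : Bool) (f : Fin n → ℕ) →
               sum (λ k → if b k then (if c then f k else 0) else 0)
               ≡ (if c then sum (λ k → if b k then f k else 0) else 0)
sum-if-const b true  f = refl
sum-if-const b false f = sum-zero _ λ k → if-0 (b k)
  where
  if-0 : ∀ b → (if b then 0 else 0) ≡ 0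
  if-0 true  = refl
  if-0 false = refl

module Polynomials {c ℓ} (K : Field c ℓ) (d : ℕ) where
  module K = Field K
  open K using (Carrier; _≈_; 0#; 1#)
  open Poly K d
  open import Algebra.Properties.Group K.+-group using (ε⁻¹≈ε; x∙y⁻¹≈ε⇒x≈y; x≈y⇒x∙y⁻¹≈ε)
  open import Algebra.Properties.AbelianGroup K.+-abelianGroup using (⁻¹-∙-comm)
  open import Algebra.Properties.CommutativeSemigroup K.+-commutativeSemigroup using (x∙yz≈y∙xz)
  module ≈-Reasoning = Relation.Binary.Reasoning.Setoid K.setoid

  coeff-++ : ∀ (f g : Pol) m → coeff (f ++ g) m ≈ coeff f m K.+ coeff g m
  coeff-++ []             g m = K.sym (K.+-identityˡ _)
  coeff-++ ((a , m') ∷ f) g m with does (m' ≟M m)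
  ... | true  = K.trans (K.+-congˡ (coeff-++ f g m)) (K.sym (K.+-assoc _ _ _))
  ... | false = coeff-++ f g m

  coeff-neg : ∀ (f : Pol) m → coeff (-P f) m ≈ K.- coeff f m
  coeff-neg []             m = K.sym ε⁻¹≈ε
  coeff-neg ((a , m') ∷ f) m with does (m' ≟M m)
  ... | true  = K.trans (K.+-congˡ (coeff-neg f m)) (⁻¹-∙-comm a (coeff f m))
  ... | false = coeff-neg f m

  module _ {P : Mono d → Set} (P? : ∀ m → Dec (P m)) where

    sumOver : Pol → Carrier
    sumOver []            = 0#
    sumOver ((a , m) ∷ f) = if does (P? m) then a K.+ sumOver f else sumOver f

    sumOver-++ : ∀ (f g : Pol) → sumOver (f ++ g) ≈ sumOver f K.+ sumOver g
    sumOver-++ []            g = K.sym (K.+-identityˡ _)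
    sumOver-++ ((a , m) ∷ f) g with does (P? m)
    ... | true  = K.trans (K.+-congˡ (sumOver-++ f g)) (K.sym (K.+-assoc _ _ _))
    ... | false = sumOver-++ f g

    sumOver-neg : ∀ (f : Pol) → sumOver (-P f) ≈ K.- sumOver f
    sumOver-neg []            = K.sym ε⁻¹≈ε
    sumOver-neg ((a , m) ∷ f) with does (P? m)
    ... | true  = K.trans (K.+-congˡ (sumOver-neg f)) (⁻¹-∙-comm a (sumOver f))
    ... | false = sumOver-neg f

  removeMono : Mono d → Pol → Pol
  removeMono m []             = []
  removeMono m ((a , m') ∷ f) = if does (m' ≟M m) then removeMono m f else (a , m') ∷ removeMono m f

  removeMono-head : ∀ m a (f : Pol) → removeMono m ((a , m) ∷ f) ≡ removeMono m f
  removeMono-head m a f = cong (if_then removeMono m f else (a , m) ∷ removeMono m f) (dec-true (m ≟M m) refl)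

  length-removeMono : ∀ m (f : Pol) → length (removeMono m f) ≤ length f
  length-removeMono m []             = z≤n
  length-removeMono m ((a , m') ∷ f) with does (m' ≟M m)
  ... | true  = ℕₚ.m≤n⇒m≤1+n (length-removeMono m f)
  ... | false = s≤s (length-removeMono m f)

  coeff-removeMono-≡ : ∀ m (f : Pol) → coeff (removeMono m f) m ≈ 0#
  coeff-removeMono-≡ m []             = K.refl
  coeff-removeMono-≡ m ((a , m') ∷ f) with m' ≟M m
  ... | yes _   = coeff-removeMono-≡ m f
  ... | no m'≢m rewrite dec-false (m' ≟M m) m'≢m = coeff-removeMono-≡ m f

  coeff-removeMono-≢ : ∀ m m₀ (f : Pol) → m₀ ≢ m → coeff (removeMono m f) m₀ ≈ coeff f m₀
  coeff-removeMono-≢ m m₀ []             _     = K.refl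
  coeff-removeMono-≢ m m₀ ((a , m') ∷ f) m₀≢m with m' ≟M m
  ... | yes refl rewrite dec-false (m' ≟M m₀) (m₀≢m ∘ sym) = coeff-removeMono-≢ m m₀ f m₀≢m
  ... | no _ with does (m' ≟M m₀)
  ...   | true  = K.+-congˡ (coeff-removeMono-≢ m m₀ f m₀≢m)
  ...   | false = coeff-removeMono-≢ m m₀ f m₀≢m

  module _ {P : Mono d → Set} (P? : ∀ m → Dec (P m)) where

    sumOver-removeMono : ∀ m (f : Pol) →
                         sumOver P? f ≈ (if does (P? m) then coeff f m else 0#) K.+ sumOver P? (removeMono m f)
    sumOver-removeMono m [] with does (P? m)
    ... | true  = K.sym (K.+-identityˡ 0#)
    ... | false = K.sym (K.+-identityˡ 0#)
    sumOver-removeMono m ((a , m') ∷ f) with m' ≟M m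
    sumOver-removeMono m ((a , m) ∷ f) | yes refl with does (P? m) | sumOver-removeMono m f
    ... | true  | ih = K.trans (K.+-congˡ ih) (K.sym (K.+-assoc _ _ _))
    ... | false | ih = ih
    sumOver-removeMono m ((a , m') ∷ f) | no _ with does (P? m') | sumOver-removeMono m f
    ... | true  | ih = K.trans (K.+-congˡ ih) (x∙yz≈y∙xz a _ _)
    ... | false | ih = ih

    -- A monomial may occur in several terms, so all terms of the first monomial are removed
    -- together before recursing.
    sumOver-vanishes′ : ∀ n (f : Pol) → length f ≤ n → (∀ m → P m → coeff f m ≈ 0#) →
                        sumOver P? f ≈ 0#
    sumOver-vanishes′ n       []            _           _      = K.refl
    sumOver-vanishes′ (suc n) ((a , m) ∷ f) (s≤s len≤n) coeff≈0 = begin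
      sumOver P? ((a , m) ∷ f)
        ≈⟨ sumOver-removeMono m ((a , m) ∷ f) ⟩
      (if does (P? m) then coeff ((a , m) ∷ f) m else 0#) K.+ sumOver P? (removeMono m ((a , m) ∷ f))
        ≈⟨ K.+-cong at-m rest ⟩
      0# K.+ 0#
        ≈⟨ K.+-identityˡ 0# ⟩
      0# ∎
      where
      open ≈-Reasoning
      at-m : (if does (P? m) then coeff ((a , m) ∷ f) m else 0#) ≈ 0#
      at-m with P? m
      ... | yes pm = coeff≈0 m pm
      ... | no _   = K.refl
      rest : sumOver P? (removeMono m ((a , m) ∷ f)) ≈ 0#
      rest = sumOver-vanishes′ n (removeMono m ((a , m) ∷ f))
        (subst (λ g → length g ≤ n) (sym (removeMono-head m a f))
               (ℕₚ.≤-trans (length-removeMono m f) len≤n))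
        λ m₀ pm₀ → case-on m₀ pm₀ (m₀ ≟M m)
        where
        case-on : ∀ m₀ → P m₀ → Dec (m₀ ≡ m) → coeff (removeMono m ((a , m) ∷ f)) m₀ ≈ 0#
        case-on m₀ _   (yes refl) = coeff-removeMono-≡ m₀ ((a , m₀) ∷ f)
        case-on m₀ pm₀ (no m₀≢m)  =
          K.trans (coeff-removeMono-≢ m m₀ ((a , m) ∷ f) m₀≢m) (coeff≈0 m₀ pm₀)

    sumOver-cong : ∀ (f g : Pol) → (∀ m → P m → coeff f m ≈ coeff g m) → sumOver P? f ≈ sumOver P? g
    sumOver-cong f g f≈g = x∙y⁻¹≈ε⇒x≈y _ _ (begin
      sumOver P? f K.+ K.- sumOver P? g   ≈⟨ K.+-congˡ (sumOver-neg P? g) ⟨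
      sumOver P? f K.+ sumOver P? (-P g)  ≈⟨ sumOver-++ P? f (-P g) ⟨
      sumOver P? (f -P g)                 ≈⟨ sumOver-vanishes′ _ (f -P g) ℕₚ.≤-refl coeff≈0 ⟩
      0#                                  ∎)
      where
      open ≈-Reasoning
      coeff≈0 : ∀ m → P m → coeff (f -P g) m ≈ 0#
      coeff≈0 m pm =
        K.trans (coeff-++ f (-P g) m) (K.trans (K.+-congˡ (coeff-neg g m)) (x≈y⇒x∙y⁻¹≈ε (f≈g m pm)))

  cancel-pair : ∀ a r → a K.* 1# K.+ (a K.* K.- 1# K.+ r) ≈ r
  cancel-pair a r = begin
    a K.* 1# K.+ (a K.* K.- 1# K.+ r)   ≈⟨ K.+-assoc _ _ _ ⟨
    a K.* 1# K.+ a K.* K.- 1# K.+ r     ≈⟨ K.+-congʳ (K.distribˡ a 1# (K.- 1#)) ⟨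
    a K.* (1# K.+ K.- 1#) K.+ r         ≈⟨ K.+-congʳ (K.*-congˡ (K.-‿inverseʳ 1#)) ⟩
    a K.* 0# K.+ r                      ≈⟨ K.+-congʳ (K.zeroʳ a) ⟩
    0# K.+ r                            ≈⟨ K.+-identityˡ r ⟩
    r                                   ∎
    where open ≈-Reasoning

  sumOver-generator : ∀ {P : Mono d → Set} (P? : ∀ m → Dec (P m)) (u v : Mono d) →
                      (∀ t → P (t ⊕ u) ⇔ P (t ⊕ v)) → ∀ cof → sumOver P? (cof *P binom u v) ≈ 0#
  sumOver-generator P? u v P⇔ []              = K.refl
  sumOver-generator P? u v P⇔ ((a , t) ∷ cof)
    with does (P? (t ⊕ u)) | does (P? (t ⊕ v)) | does-⇔ (P⇔ t) (P? (t ⊕ u)) (P? (t ⊕ v))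
  ... | true  | true  | _ = K.trans (cancel-pair a _) (sumOver-generator P? u v P⇔ cof)
  ... | false | false | _ = sumOver-generator P? u v P⇔ cof

  sumOver-single : ∀ {P : Mono d → Set} (P? : ∀ m → Dec (P m)) {m} a → P m →
                   sumOver P? ((a , m) ∷ []) ≈ a
  sumOver-single P? {m} a pm rewrite dec-true (P? m) pm = K.+-identityʳ a

  SameFibre? : ∀ (m m' : Mono d) → Dec (SameFibre m m')
  SameFibre? m m' = Finₚ.all? λ r → Amul m r ℤ.≟ Amul m' r

  combination : Generator → Pol
  combination g = Generator.cof g *P binom (Generator.u g) (Generator.v g)

  sumOver-fibre-ideal : ∀ m (gs : List Generator) →
                        sumOver (λ m' → SameFibre? m' m) (sumP (List.map combination gs)) ≈ 0#
  sumOver-fibre-ideal m []       = K.refl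
  sumOver-fibre-ideal m (g ∷ gs) = begin
    sumOver P? (combination g ++ sumP (List.map combination gs))
      ≈⟨ sumOver-++ P? (combination g) _ ⟩
    sumOver P? (combination g) K.+ sumOver P? (sumP (List.map combination gs))
      ≈⟨ K.+-cong (sumOver-generator P? u v P⇔ (Generator.cof g)) (sumOver-fibre-ideal m gs) ⟩
    0# K.+ 0#
      ≈⟨ K.+-identityˡ 0# ⟩
    0# ∎
    where
    open ≈-Reasoning
    open Generator g using (u; v; Au≡Av)
    P? = λ m' → SameFibre? m' m
    P⇔ : ∀ t → SameFibre (t ⊕ u) m ⇔ SameFibre (t ⊕ v) m
    P⇔ t = mk⇔ (SameFibre-trans {m₁ = t ⊕ v} {t ⊕ u} {m} (sym ∘ tu∼tv))
               (SameFibre-trans {m₁ = t ⊕ u} {t ⊕ v} {m} tu∼tv)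
      where tu∼tv = SameFibre-⊕ˡ t {u} {v} Au≡Av

  valid? : ∀ (m : Mono d) → Dec (ValidMono m)
  valid? m = Finₚ.all? λ i → Finₚ.all? λ j → ¬? (i Fin.<? j) →-dec (ex m i j ℕ.≟ 0)

  coeff-invalid : ∀ (f : Pol) → ValidPol f → ∀ m → ¬ ValidMono m → coeff f m ≈ 0#
  coeff-invalid []             []        m ¬vm = K.refl
  coeff-invalid ((a , m') ∷ f) (vm' ∷ vf) m ¬vm with m' ≟M m
  ... | yes refl = ⊥-elim (¬vm vm')
  ... | no _     = coeff-invalid f vf m ¬vm

  leading-monomial-not-standard : ∀ f m → InIA f → IsLM f m → ¬ Standard m
  leading-monomial-not-standard f m (vf , gs , f≈comb) (cm≉0 , above≈0) sm with valid? m
  ... | no ¬vm = cm≉0 (coeff-invalid f vf m ¬vm)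
  ... | yes vm = cm≉0 (begin
    coeff f m                                          ≈⟨ sumOver-single P? {m} (coeff f m) (λ _ → refl) ⟨
    sumOver P? ((coeff f m , m) ∷ [])                  ≈⟨ sumOver-cong P? f ((coeff f m , m) ∷ []) only-m ⟨
    sumOver P? f                                       ≈⟨ sumOver-cong P? f combined (λ m' _ → f≈comb m') ⟩
    sumOver P? combined                                ≈⟨ sumOver-fibre-ideal m gs ⟩
    0#                                                 ∎)
    where
    open ≈-Reasoning
    P? = λ m' → SameFibre? m' m
    combined = sumP (List.map combination gs)
    only-m : ∀ m' → SameFibre m' m → coeff f m' ≈ coeff ((coeff f m , m) ∷ []) m'
    only-m m' m'∼m with m ≟M m'
    ... | yes refl = K.sym (K.+-identityʳ _)
    ... | no m≢m' with valid? m'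
    ...   | yes vm' = above≈0 m' vm' (standard-least m m' vm sm vm' m'∼m (m≢m' ∘ sym))
    ...   | no ¬vm' = coeff-invalid f vf m' ¬vm'

  coeff-binom-lead : ∀ (u v : Mono d) → u ≢ v → coeff (binom u v) u ≈ 1#
  coeff-binom-lead u v u≢v rewrite dec-true (u ≟M u) refl | dec-false (v ≟M u) (u≢v ∘ sym) = K.+-identityʳ 1#

  coeff-binom-support : ∀ (u v m : Mono d) → ¬ (coeff (binom u v) m ≈ 0#) → m ≡ u ⊎ m ≡ v
  coeff-binom-support u v m c≉0 with u ≟M m | v ≟M m
  ... | yes u≡m | _       = inj₁ (sym u≡m)
  ... | no _    | yes v≡m = inj₂ (sym v≡m)
  ... | no _    | no _    = ⊥-elim (c≉0 K.refl)

  coeff-binom-other : ∀ (u v m : Mono d) → m ≢ u → m ≢ v → coeff (binom u v) m ≈ 0#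
  coeff-binom-other u v m m≢u m≢v
    rewrite dec-false (u ≟M m) (m≢u ∘ sym) | dec-false (v ≟M m) (m≢v ∘ sym) = K.refl

  1≉0 : ¬ (1# ≈ 0#)
  1≉0 1≈0 = K.0≉1 (K.sym 1≈0)

  IsLM-binom : ∀ (u v : Mono d) → u ≻ v → IsLM (binom u v) u
  IsLM-binom u v u≻v =
    (λ c≈0 → 1≉0 (K.trans (K.sym (coeff-binom-lead u v u≢v)) c≈0)) ,
    λ m _ m≻u → coeff-binom-other u v m (λ { refl → ≻-irrefl u m≻u })
                                         (λ { refl → ≻-asym {m₁ = u} {v} u≻v m≻u })
    where
    u≢v : u ≢ v
    u≢v refl = ≻-irrefl u u≻v

  IsLM-binom-unique : ∀ (u v m : Mono d) → u ≻ v → ValidMono u → IsLM (binom u v) m → m ≡ u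
  IsLM-binom-unique u v m u≻v vu (c≉0 , above≈0) with coeff-binom-support u v m c≉0
  ... | inj₁ m≡u  = m≡u
  ... | inj₂ refl = ⊥-elim (IsLM-binom u v u≻v .proj₁ (above≈0 u vu u≻v))

  binom-InIA : ∀ (u v : Mono d) → ValidMono u → ValidMono v → SameFibre u v → InIA (binom u v)
  binom-InIA u v vu vv u∼v = (vu ∷ vv ∷ []) , (generator ∷ []) , binom≈combination
    where
    generator : Generator
    generator = record { cof = mon one ; cofOK = valid-one ∷ [] ; u = u ; v = v
                       ; uOK = vu ; vOK = vv ; Au≡Av = u∼v }
    binom≈combination : binom u v ≈P sumP (List.map combination (generator ∷ []))
    binom≈combination m rewrite one-⊕ u | one-⊕ v with does (u ≟M m) | does (v ≟M m)
    ... | true  | true  = K.+-cong (K.sym (K.*-identityˡ 1#)) (K.+-congʳ (K.sym (K.*-identityˡ (K.- 1#))))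
    ... | true  | false = K.+-congʳ (K.sym (K.*-identityˡ 1#))
    ... | false | true  = K.+-congʳ (K.sym (K.*-identityˡ (K.- 1#)))
    ... | false | false = K.refl

  binomialOf : Key d → Pol
  binomialOf x = binom (lead x) (trail x)

  keys : List (Key d)
  keys = List.map inj₁ triples ++ List.map inj₂ quadruples

  keyBasis : List Pol
  keyBasis = List.map binomialOf keys

  basis≡keyBasis : basis ≡ keyBasis
  basis≡keyBasis = sym (trans (Listₚ.map-++ binomialOf (List.map inj₁ triples) (List.map inj₂ quadruples))
                              (cong₂ _++_ (sym (Listₚ.map-∘ triples)) (sym (Listₚ.map-∘ quadruples))))

  triplesFrom : Fin d → Fin d → List (Fin d × Fin d × Fin d)
  triplesFrom i j = List.map (λ k → (i , j , k)) (List.allFin d)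

  triplesFrom₁ : Fin d → List (Fin d × Fin d × Fin d)
  triplesFrom₁ i = List.concatMap (triplesFrom i) (List.allFin d)

  allTriples : List (Fin d × Fin d × Fin d)
  allTriples = List.concatMap triplesFrom₁ (List.allFin d)

  <₁₂? : ∀ (t : Fin d × Fin d × Fin d) → Dec (proj₁ t Fin.< proj₁ (proj₂ t))
  <₁₂? t = proj₁ t Fin.<? proj₁ (proj₂ t)

  <₂₃? : ∀ (t : Fin d × Fin d × Fin d) → Dec (proj₁ (proj₂ t) Fin.< proj₂ (proj₂ t))
  <₂₃? t = proj₁ (proj₂ t) Fin.<? proj₂ (proj₂ t)

  extensions : Fin d × Fin d × Fin d → List (Fin d × Fin d × Fin d × Fin d)
  extensions (i , j , k) = List.map (λ l → (i , j , k , l)) (List.filter (k Fin.<?_) (List.allFin d))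

  triple∈⇒increasing : ∀ {t} → t ∈ triples → Increasing (inj₁ t)
  triple∈⇒increasing t∈ with ∈-filter⁻ <₁₂? {xs = List.filter <₂₃? allTriples} t∈
  ... | t∈′ , i<j = i<j , proj₂ (∈-filter⁻ <₂₃? {xs = allTriples} t∈′)

  increasing⇒triple∈ : ∀ {i j k} → Increasing (inj₁ (i , j , k)) → (i , j , k) ∈ triples
  increasing⇒triple∈ {i} {j} {k} (i<j , j<k) = ∈-filter⁺ <₁₂? (∈-filter⁺ <₂₃? ∈allTriples j<k) i<j
    where
    ∈allTriples : (i , j , k) ∈ allTriples
    ∈allTriples = ∈-concatMap⁺ triplesFrom₁ (lose (∈-allFin i)
                    (∈-concatMap⁺ (triplesFrom i) (lose (∈-allFin j) (∈-map⁺ _ (∈-allFin k)))))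

  quadruple∈⇒increasing : ∀ {q} → q ∈ quadruples → Increasing (inj₂ q)
  quadruple∈⇒increasing q∈ with find (∈-concatMap⁻ extensions {xs = triples} q∈)
  ... | (i , j , k) , t∈ , q∈ext with ∈-map⁻ (λ l → (i , j , k , l)) q∈ext
  ...   | l , l∈ , refl = i<j , j<k , proj₂ (∈-filter⁻ (k Fin.<?_) {xs = List.allFin d} l∈)
    where
    i<j = proj₁ (triple∈⇒increasing t∈)
    j<k = proj₂ (triple∈⇒increasing t∈)

  increasing⇒quadruple∈ : ∀ {i j k l} → Increasing (inj₂ (i , j , k , l)) → (i , j , k , l) ∈ quadruples
  increasing⇒quadruple∈ {i} {j} {k} {l} (i<j , j<k , k<l) =
    ∈-concatMap⁺ extensions
      (lose (increasing⇒triple∈ (i<j , j<k)) (∈-map⁺ _ (∈-filter⁺ (k Fin.<?_) (∈-allFin l) k<l)))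

  key∈⇒increasing : ∀ {x} → x ∈ keys → Increasing x
  key∈⇒increasing x∈ with ∈-++⁻ (List.map inj₁ triples) x∈
  ... | inj₁ x∈₁ with ∈-map⁻ inj₁ x∈₁
  ...   | _ , t∈ , refl = triple∈⇒increasing t∈
  key∈⇒increasing x∈ | inj₂ x∈₂ with ∈-map⁻ inj₂ x∈₂
  ...   | _ , q∈ , refl = quadruple∈⇒increasing q∈

  increasing⇒key∈ : ∀ x → Increasing x → x ∈ keys
  increasing⇒key∈ (inj₁ _) inc = ∈-++⁺ˡ (∈-map⁺ inj₁ (increasing⇒triple∈ inc))
  increasing⇒key∈ (inj₂ _) inc =
    ∈-++⁺ʳ (List.map inj₁ triples) (∈-map⁺ inj₂ (increasing⇒quadruple∈ inc))

  Unique-allTriples : Unique allTriples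
  Unique-allTriples = Unique-concatMap triplesFrom₁ proj₁ (Uniqueₚ.allFin⁺ d)
    (λ i → Unique-concatMap (triplesFrom i) (proj₁ ∘ proj₂) (Uniqueₚ.allFin⁺ d)
             (λ j → Uniqueₚ.map⁺ (cong (proj₂ ∘ proj₂)) (Uniqueₚ.allFin⁺ d))
             second-is)
    first-is
    where
    second-is : ∀ {i j t} → t ∈ triplesFrom i j → proj₁ (proj₂ t) ≡ j
    second-is {i} {j} t∈ with ∈-map⁻ (λ k → (i , j , k)) t∈
    ... | _ , _ , refl = refl
    first-is : ∀ {i t} → t ∈ triplesFrom₁ i → proj₁ t ≡ i
    first-is {i} t∈ with find (∈-concatMap⁻ (triplesFrom i) {xs = List.allFin d} t∈)
    ... | j , _ , t∈ij with ∈-map⁻ (λ k → (i , j , k)) t∈ij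
    ...   | _ , _ , refl = refl

  Unique-triples : Unique triples
  Unique-triples = Uniqueₚ.filter⁺ <₁₂? (Uniqueₚ.filter⁺ <₂₃? Unique-allTriples)

  Unique-quadruples : Unique quadruples
  Unique-quadruples = Unique-concatMap extensions prefix Unique-triples
    (λ t → Uniqueₚ.map⁺ (cong (proj₂ ∘ proj₂ ∘ proj₂)) (Uniqueₚ.filter⁺ _ (Uniqueₚ.allFin⁺ d)))
    prefix-is
    where
    prefix : Fin d × Fin d × Fin d × Fin d → Fin d × Fin d × Fin d
    prefix (i , j , k , _) = i , j , k
    prefix-is : ∀ {t q} → q ∈ extensions t → prefix q ≡ t
    prefix-is {i , j , k} q∈ with ∈-map⁻ (λ l → (i , j , k , l)) q∈
    ... | _ , _ , refl = refl

  Unique-keys : Unique keys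
  Unique-keys = Uniqueₚ.++⁺ (Uniqueₚ.map⁺ Sumₚ.inj₁-injective Unique-triples)
                            (Uniqueₚ.map⁺ Sumₚ.inj₂-injective Unique-quadruples) disjoint
    where
    disjoint : Disjoint (List.map inj₁ triples) (List.map inj₂ quadruples)
    disjoint (x∈₁ , x∈₂) with ∈-map⁻ inj₁ x∈₁ | ∈-map⁻ inj₂ x∈₂
    ... | _ , _ , refl | _ , _ , ()

  keyAt : Fin (length keyBasis) → Key d
  keyAt p = lookup keys (Fin.cast (Listₚ.length-map binomialOf keys) p)

  lookup-keyAt : ∀ p → lookup keyBasis p ≡ binomialOf (keyAt p)
  lookup-keyAt = lookup-map binomialOf keys

  keyAt-increasing : ∀ p → Increasing (keyAt p)
  keyAt-increasing p = key∈⇒increasing (∈-lookup {xs = keys} _)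

  keyAt-injective : ∀ p q → keyAt p ≡ keyAt q → p ≡ q
  keyAt-injective p q eq =
    cast-injective (Listₚ.length-map binomialOf keys) (Unique⇒lookup-injective Unique-keys _ _ eq)

  IsLM-binomialOf : ∀ (x : Key d) → Increasing x → IsLM (binomialOf x) (lead x)
  IsLM-binomialOf x inc = IsLM-binom (lead x) (trail x) (lead≻trail x inc)

  lead≢trail : ∀ (x : Key d) → Increasing x → lead x ≢ trail x
  lead≢trail x inc eq = ≻-irrefl (lead x) (subst (lead x ≻_) (sym eq) (lead≻trail x inc))

  lead∤monomial-of-other : ∀ p q → p ≢ q → ∀ m → ¬ (coeff (binomialOf (keyAt p)) m ≈ 0#) →
                           ¬ (lead (keyAt q) ∣M m)
  lead∤monomial-of-other p q p≢q m c≉0 with coeff-binom-support (lead (keyAt p)) (trail (keyAt p)) m c≉0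
  ... | inj₁ refl =
    p≢q ∘ keyAt-injective p q ∘ lead∣lead⇒≡ (keyAt p) (keyAt q) (keyAt-increasing p) (keyAt-increasing q)
  ... | inj₂ refl = trail-standard (keyAt p) (keyAt-increasing p) (keyAt q) (keyAt-increasing q)

  binomialOf-InIA : ∀ (x : Key d) → Increasing x → InIA (binomialOf x)
  binomialOf-InIA x inc = binom-InIA (lead x) (trail x) (valid-lead x inc) (valid-trail x inc) (lead∼trail x inc)

  keyBasis-monic : ∀ p → Σ (Mono d) λ m → IsLM (lookup keyBasis p) m × coeff (lookup keyBasis p) m ≈ 1#
  keyBasis-monic p rewrite lookup-keyAt p =
    lead x , IsLM-binomialOf x (keyAt-increasing p) ,
    coeff-binom-lead (lead x) (trail x) (lead≢trail x (keyAt-increasing p))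
    where x = keyAt p

  keyBasis-gröbner : ∀ f m → InIA f → IsLM f m →
                     Σ (Fin (length keyBasis)) λ p → Σ (Mono d) λ mp →
                     IsLM (lookup keyBasis p) mp × (mp ∣M m)
  keyBasis-gröbner f m f∈I lm with standard? m
  ... | inj₁ sm = ⊥-elim (leading-monomial-not-standard f m f∈I lm sm)
  ... | inj₂ (x , inc , x∣m) =
    Any.index x∈ , lead x ,
    subst (λ g → IsLM g (lead x)) (Anyₚ.lookup-index x∈) (IsLM-binomialOf x inc) , x∣m
    where x∈ = ∈-map⁺ binomialOf (increasing⇒key∈ x inc)

  keyBasis-reduced : ∀ p q → p ≢ q → ∀ m mq → ¬ (coeff (lookup keyBasis p) m ≈ 0#) →
                     IsLM (lookup keyBasis q) mq → ¬ (mq ∣M m)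
  keyBasis-reduced p q p≢q m mq c≉0 lm rewrite lookup-keyAt p | lookup-keyAt q
    with IsLM-binom-unique (lead (keyAt q)) (trail (keyAt q)) mq (lead≻trail _ (keyAt-increasing q))
                           (valid-lead _ (keyAt-increasing q)) lm
  ... | refl = lead∤monomial-of-other p q p≢q m c≉0

  keyBasis-IsReducedGB : IsReducedGB keyBasis
  keyBasis-IsReducedGB = record
    { inIdeal = λ p → subst InIA (sym (lookup-keyAt p)) (binomialOf-InIA (keyAt p) (keyAt-increasing p))
    ; monic   = keyBasis-monic
    ; gröbner = keyBasis-gröbner
    ; reduced = keyBasis-reduced
    }

  keyBasis-distinct : ∀ p q → p ≢ q → ¬ (lookup keyBasis p ≈P lookup keyBasis q)
  keyBasis-distinct p q p≢q fp≈fq rewrite lookup-keyAt p | lookup-keyAt q =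
    lead∤monomial-of-other q p (p≢q ∘ sym) (lead x) c≉0 (∣M-reflexive {m = lead x} refl)
    where
    x = keyAt p
    c≉0 : ¬ (coeff (binomialOf (keyAt q)) (lead x) ≈ 0#)
    c≉0 c≈0 = 1≉0 (K.trans (K.sym (coeff-binom-lead (lead x) (trail x) (lead≢trail x (keyAt-increasing p))))
                           (K.trans (fp≈fq (lead x)) c≈0))

  listSum-triples : ∀ (g : Fin d × Fin d × Fin d → ℕ) → listSum g triples ≡
    sum λ i → sum λ j → if does (i Fin.<? j) then sum (λ k → if does (j Fin.<? k) then g (i , j , k) else 0) else 0
  listSum-triples g = begin
    listSum g triples
      ≡⟨ listSum-filter <₁₂? (List.filter <₂₃? allTriples) g ⟩
    listSum (λ t → if does (<₁₂? t) then g t else 0) (List.filter <₂₃? allTriples)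
      ≡⟨ listSum-filter <₂₃? allTriples _ ⟩
    listSum g-if allTriples
      ≡⟨ listSum-concatMap triplesFrom₁ (List.allFin d) g-if ⟩
    listSum (λ i → listSum g-if (triplesFrom₁ i)) (List.allFin d)
      ≡⟨ listSum-allFin (λ i → listSum g-if (triplesFrom₁ i)) ⟩
    sum (λ i → listSum g-if (triplesFrom₁ i))
      ≡⟨ sum-cong-≗ (λ i → trans (listSum-concatMap (triplesFrom i) (List.allFin d) g-if)
                           (trans (listSum-allFin (λ j → listSum g-if (triplesFrom i j))) (sum-cong-≗ (inner i)))) ⟩
    (sum λ i → sum λ j → if does (i Fin.<? j) then sum (λ k → if does (j Fin.<? k) then g (i , j , k) else 0) else 0) ∎
    where
    open ≡-Reasoning
    g-if : Fin d × Fin d × Fin d → ℕ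
    g-if t = if does (<₂₃? t) then (if does (<₁₂? t) then g t else 0) else 0
    inner : ∀ i j → listSum g-if (triplesFrom i j)
                  ≡ (if does (i Fin.<? j) then sum (λ k → if does (j Fin.<? k) then g (i , j , k) else 0) else 0)
    inner i j = trans (listSum-map (λ k → (i , j , k)) (List.allFin d) g-if)
                (trans (listSum-allFin (λ k → g-if (i , j , k)))
                       (sum-if-const (λ k → does (j Fin.<? k)) (does (i Fin.<? j)) (λ k → g (i , j , k))))

  length-triples : length triples ≡ d C 3
  length-triples = trans (length≡listSum triples) (trans (listSum-triples (λ _ → 1)) (sum-chains d 2))

  length-quadruples : length quadruples ≡ d C 4
  length-quadruples = begin
    length quadruples                                        ≡⟨ length≡listSum quadruples ⟩
    listSum (λ _ → 1) (List.concatMap extensions triples)    ≡⟨ listSum-concatMap extensions triples _ ⟩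
    listSum (λ t → listSum (λ _ → 1) (extensions t)) triples ≡⟨ listSum-cong triples extensions-count ⟩
    listSum (λ t → chains 1 (proj₂ (proj₂ t))) triples       ≡⟨ listSum-triples _ ⟩
    sum (chains {d} 3)                                       ≡⟨ sum-chains d 3 ⟩
    d C 4                                                    ∎
    where
    open ≡-Reasoning
    extensions-count : ∀ t → listSum (λ _ → 1) (extensions t) ≡ chains 1 (proj₂ (proj₂ t))
    extensions-count (i , j , k) =
      trans (listSum-map _ (List.filter (k Fin.<?_) (List.allFin d)) _)
            (trans (listSum-filter (k Fin.<?_) (List.allFin d) _)
                   (listSum-allFin {d} (λ l → if does (k Fin.<? l) then 1 else 0)))

  length-basis : length basis ≡ d C 3 + d C 4
  length-basis = trans (Listₚ.length-++ G₁)
    (cong₂ _+_ (trans (Listₚ.length-map _ triples) length-triples)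
               (trans (Listₚ.length-map _ quadruples) length-quadruples))

proposition4p7 : ∀ {c ℓ : Level} (K : Field c ℓ) (d : ℕ) →
    let open Poly K d in
    IsReducedGB basis
    × (∀ (p q : Fin (length basis)) → ¬ (p ≡ q) → ¬ (lookup basis p ≈P lookup basis q))
    × (length basis ≡ (d C 3) + (d C 4))
proposition4p7 K d =
  subst IsReducedGB (sym basis≡keyBasis) keyBasis-IsReducedGB ,
  subst (λ B → ∀ (p q : Fin (length B)) → ¬ (p ≡ q) → ¬ (lookup B p ≈P lookup B q))
        (sym basis≡keyBasis) keyBasis-distinct ,
  length-basis
  where
  open Poly K d
  open Polynomials K d
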